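{- Every switch cograph is a perfect graph.
   Context: A switch cograph is a finite simple undirected graph containing none of the following as an induced subgraph: the Gem (a path $P_4$ together with a vertex adjacent to all four of its vertices), the Co-gem (the complement of the Gem, i.e. $P_4$ plus an isolated vertex), the Bull (a triangle with two further vertices, each adjacent to exactly one triangle vertex, these two triangle vertices being distinct), and the cycle $C_5$. -}

module Defs where

open import Data.Nat using (ℕ; _≤_)
open import Data.Fin using (Fin; zero; suc)
open import Data.Bool using (Bool; true; false)
open import Data.Product using (Σ; ∃; _×_; _,_)
open import Relation.Binary.PropositionalEquality using (_≡_; _≢_; refl)
open import Relation.Nullary using (¬_)
open import Function.Definitions using (Injective)

record Graph : Set where
  field
    n      : ℕ
    E      : Fin n → Fin n → Bool
    sym    : ∀ x y → E x y ≡ E y x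
    irrefl : ∀ x → E x x ≡ false

open Graph public

Adj : (G : Graph) → Fin (n G) → Fin (n G) → Set
Adj G x y = E G x y ≡ true

-- The subgraph of G induced on the image of f : Fin m → Fin (n G)
-- (f is required to be injective wherever this is used).
induced : (G : Graph) (m : ℕ) → (Fin m → Fin (n G)) → Graph
induced G m f = record
  { n = m
  ; E = λ x y → E G (f x) (f y)
  ; sym = λ x y → sym G (f x) (f y)
  ; irrefl = λ x → irrefl G (f x)
  }

ContainsInduced : Graph → Graph → Set
ContainsInduced G H =
  Σ (Fin (n H) → Fin (n G)) λ f →
    Injective _≡_ _≡_ f × (∀ x y → E G (f x) (f y) ≡ E H x y)

HasClique : (G : Graph) → ℕ → Set
HasClique G k = Σ (Fin k → Fin (n G)) λ f →
  Injective _≡_ _≡_ f × (∀ i j → i ≢ j → Adj G (f i) (f j))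

Colourable : (G : Graph) → ℕ → Set
Colourable G k = Σ (Fin (n G) → Fin k) λ c →
  ∀ x y → Adj G x y → c x ≢ c y

IsCliqueNumber : Graph → ℕ → Set
IsCliqueNumber G k = HasClique G k × (∀ j → HasClique G j → j ≤ k)

IsChromaticNumber : Graph → ℕ → Set
IsChromaticNumber G k = Colourable G k × (∀ j → Colourable G j → k ≤ j)

Perfect : Graph → Set
Perfect G = ∀ (m : ℕ) (f : Fin m → Fin (n G)) → Injective _≡_ _≡_ f →
  ∃ λ k → IsChromaticNumber (induced G m f) k × IsCliqueNumber (induced G m f) k

-- Gem on vertices 0..4, edges [(0, 1), (1, 2), (2, 3), (4, 0), (4, 1), (4, 2), (4, 3)]
Gem-E : Fin 5 → Fin 5 → Bool
Gem-E zero zero = false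
Gem-E zero (suc zero) = true
Gem-E zero (suc (suc zero)) = false
Gem-E zero (suc (suc (suc zero))) = false
Gem-E zero (suc (suc (suc (suc zero)))) = true
Gem-E (suc zero) zero = true
Gem-E (suc zero) (suc zero) = false
Gem-E (suc zero) (suc (suc zero)) = true
Gem-E (suc zero) (suc (suc (suc zero))) = false
Gem-E (suc zero) (suc (suc (suc (suc zero)))) = true
Gem-E (suc (suc zero)) zero = false
Gem-E (suc (suc zero)) (suc zero) = true
Gem-E (suc (suc zero)) (suc (suc zero)) = false
Gem-E (suc (suc zero)) (suc (suc (suc zero))) = true
Gem-E (suc (suc zero)) (suc (suc (suc (suc zero)))) = true
Gem-E (suc (suc (suc zero))) zero = false
Gem-E (suc (suc (suc zero))) (suc zero) = false
Gem-E (suc (suc (suc zero))) (suc (suc zero)) = true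
Gem-E (suc (suc (suc zero))) (suc (suc (suc zero))) = false
Gem-E (suc (suc (suc zero))) (suc (suc (suc (suc zero)))) = true
Gem-E (suc (suc (suc (suc zero)))) zero = true
Gem-E (suc (suc (suc (suc zero)))) (suc zero) = true
Gem-E (suc (suc (suc (suc zero)))) (suc (suc zero)) = true
Gem-E (suc (suc (suc (suc zero)))) (suc (suc (suc zero))) = true
Gem-E (suc (suc (suc (suc zero)))) (suc (suc (suc (suc zero)))) = false

Gem-sym : ∀ x y → Gem-E x y ≡ Gem-E y x
Gem-sym zero zero = refl
Gem-sym zero (suc zero) = refl
Gem-sym zero (suc (suc zero)) = refl
Gem-sym zero (suc (suc (suc zero))) = refl
Gem-sym zero (suc (suc (suc (suc zero)))) = refl
Gem-sym (suc zero) zero = refl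
Gem-sym (suc zero) (suc zero) = refl
Gem-sym (suc zero) (suc (suc zero)) = refl
Gem-sym (suc zero) (suc (suc (suc zero))) = refl
Gem-sym (suc zero) (suc (suc (suc (suc zero)))) = refl
Gem-sym (suc (suc zero)) zero = refl
Gem-sym (suc (suc zero)) (suc zero) = refl
Gem-sym (suc (suc zero)) (suc (suc zero)) = refl
Gem-sym (suc (suc zero)) (suc (suc (suc zero))) = refl
Gem-sym (suc (suc zero)) (suc (suc (suc (suc zero)))) = refl
Gem-sym (suc (suc (suc zero))) zero = refl
Gem-sym (suc (suc (suc zero))) (suc zero) = refl
Gem-sym (suc (suc (suc zero))) (suc (suc zero)) = refl
Gem-sym (suc (suc (suc zero))) (suc (suc (suc zero))) = refl
Gem-sym (suc (suc (suc zero))) (suc (suc (suc (suc zero)))) = refl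
Gem-sym (suc (suc (suc (suc zero)))) zero = refl
Gem-sym (suc (suc (suc (suc zero)))) (suc zero) = refl
Gem-sym (suc (suc (suc (suc zero)))) (suc (suc zero)) = refl
Gem-sym (suc (suc (suc (suc zero)))) (suc (suc (suc zero))) = refl
Gem-sym (suc (suc (suc (suc zero)))) (suc (suc (suc (suc zero)))) = refl

Gem-irr : ∀ x → Gem-E x x ≡ false
Gem-irr zero = refl
Gem-irr (suc zero) = refl
Gem-irr (suc (suc zero)) = refl
Gem-irr (suc (suc (suc zero))) = refl
Gem-irr (suc (suc (suc (suc zero)))) = refl

Gem : Graph
Gem = record { n = 5 ; E = Gem-E ; sym = Gem-sym ; irrefl = Gem-irr }

-- CoGem on vertices 0..4, edges [(0, 1), (1, 2), (2, 3)]
CoGem-E : Fin 5 → Fin 5 → Bool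
CoGem-E zero zero = false
CoGem-E zero (suc zero) = true
CoGem-E zero (suc (suc zero)) = false
CoGem-E zero (suc (suc (suc zero))) = false
CoGem-E zero (suc (suc (suc (suc zero)))) = false
CoGem-E (suc zero) zero = true
CoGem-E (suc zero) (suc zero) = false
CoGem-E (suc zero) (suc (suc zero)) = true
CoGem-E (suc zero) (suc (suc (suc zero))) = false
CoGem-E (suc zero) (suc (suc (suc (suc zero)))) = false
CoGem-E (suc (suc zero)) zero = false
CoGem-E (suc (suc zero)) (suc zero) = true
CoGem-E (suc (suc zero)) (suc (suc zero)) = false
CoGem-E (suc (suc zero)) (suc (suc (suc zero))) = true
CoGem-E (suc (suc zero)) (suc (suc (suc (suc zero)))) = false
CoGem-E (suc (suc (suc zero))) zero = false
CoGem-E (suc (suc (suc zero))) (suc zero) = false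
CoGem-E (suc (suc (suc zero))) (suc (suc zero)) = true
CoGem-E (suc (suc (suc zero))) (suc (suc (suc zero))) = false
CoGem-E (suc (suc (suc zero))) (suc (suc (suc (suc zero)))) = false
CoGem-E (suc (suc (suc (suc zero)))) zero = false
CoGem-E (suc (suc (suc (suc zero)))) (suc zero) = false
CoGem-E (suc (suc (suc (suc zero)))) (suc (suc zero)) = false
CoGem-E (suc (suc (suc (suc zero)))) (suc (suc (suc zero))) = false
CoGem-E (suc (suc (suc (suc zero)))) (suc (suc (suc (suc zero)))) = false

CoGem-sym : ∀ x y → CoGem-E x y ≡ CoGem-E y x
CoGem-sym zero zero = refl
CoGem-sym zero (suc zero) = refl
CoGem-sym zero (suc (suc zero)) = refl
CoGem-sym zero (suc (suc (suc zero))) = refl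
CoGem-sym zero (suc (suc (suc (suc zero)))) = refl
CoGem-sym (suc zero) zero = refl
CoGem-sym (suc zero) (suc zero) = refl
CoGem-sym (suc zero) (suc (suc zero)) = refl
CoGem-sym (suc zero) (suc (suc (suc zero))) = refl
CoGem-sym (suc zero) (suc (suc (suc (suc zero)))) = refl
CoGem-sym (suc (suc zero)) zero = refl
CoGem-sym (suc (suc zero)) (suc zero) = refl
CoGem-sym (suc (suc zero)) (suc (suc zero)) = refl
CoGem-sym (suc (suc zero)) (suc (suc (suc zero))) = refl
CoGem-sym (suc (suc zero)) (suc (suc (suc (suc zero)))) = refl
CoGem-sym (suc (suc (suc zero))) zero = refl
CoGem-sym (suc (suc (suc zero))) (suc zero) = refl
CoGem-sym (suc (suc (suc zero))) (suc (suc zero)) = refl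
CoGem-sym (suc (suc (suc zero))) (suc (suc (suc zero))) = refl
CoGem-sym (suc (suc (suc zero))) (suc (suc (suc (suc zero)))) = refl
CoGem-sym (suc (suc (suc (suc zero)))) zero = refl
CoGem-sym (suc (suc (suc (suc zero)))) (suc zero) = refl
CoGem-sym (suc (suc (suc (suc zero)))) (suc (suc zero)) = refl
CoGem-sym (suc (suc (suc (suc zero)))) (suc (suc (suc zero))) = refl
CoGem-sym (suc (suc (suc (suc zero)))) (suc (suc (suc (suc zero)))) = refl

CoGem-irr : ∀ x → CoGem-E x x ≡ false
CoGem-irr zero = refl
CoGem-irr (suc zero) = refl
CoGem-irr (suc (suc zero)) = refl
CoGem-irr (suc (suc (suc zero))) = refl
CoGem-irr (suc (suc (suc (suc zero)))) = refl

CoGem : Graph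
CoGem = record { n = 5 ; E = CoGem-E ; sym = CoGem-sym ; irrefl = CoGem-irr }

-- Bull on vertices 0..4, edges [(0, 1), (1, 2), (0, 2), (3, 0), (4, 1)]
Bull-E : Fin 5 → Fin 5 → Bool
Bull-E zero zero = false
Bull-E zero (suc zero) = true
Bull-E zero (suc (suc zero)) = true
Bull-E zero (suc (suc (suc zero))) = true
Bull-E zero (suc (suc (suc (suc zero)))) = false
Bull-E (suc zero) zero = true
Bull-E (suc zero) (suc zero) = false
Bull-E (suc zero) (suc (suc zero)) = true
Bull-E (suc zero) (suc (suc (suc zero))) = false
Bull-E (suc zero) (suc (suc (suc (suc zero)))) = true
Bull-E (suc (suc zero)) zero = true
Bull-E (suc (suc zero)) (suc zero) = true
Bull-E (suc (suc zero)) (suc (suc zero)) = false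
Bull-E (suc (suc zero)) (suc (suc (suc zero))) = false
Bull-E (suc (suc zero)) (suc (suc (suc (suc zero)))) = false
Bull-E (suc (suc (suc zero))) zero = true
Bull-E (suc (suc (suc zero))) (suc zero) = false
Bull-E (suc (suc (suc zero))) (suc (suc zero)) = false
Bull-E (suc (suc (suc zero))) (suc (suc (suc zero))) = false
Bull-E (suc (suc (suc zero))) (suc (suc (suc (suc zero)))) = false
Bull-E (suc (suc (suc (suc zero)))) zero = false
Bull-E (suc (suc (suc (suc zero)))) (suc zero) = true
Bull-E (suc (suc (suc (suc zero)))) (suc (suc zero)) = false
Bull-E (suc (suc (suc (suc zero)))) (suc (suc (suc zero))) = false
Bull-E (suc (suc (suc (suc zero)))) (suc (suc (suc (suc zero)))) = false

Bull-sym : ∀ x y → Bull-E x y ≡ Bull-E y x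
Bull-sym zero zero = refl
Bull-sym zero (suc zero) = refl
Bull-sym zero (suc (suc zero)) = refl
Bull-sym zero (suc (suc (suc zero))) = refl
Bull-sym zero (suc (suc (suc (suc zero)))) = refl
Bull-sym (suc zero) zero = refl
Bull-sym (suc zero) (suc zero) = refl
Bull-sym (suc zero) (suc (suc zero)) = refl
Bull-sym (suc zero) (suc (suc (suc zero))) = refl
Bull-sym (suc zero) (suc (suc (suc (suc zero)))) = refl
Bull-sym (suc (suc zero)) zero = refl
Bull-sym (suc (suc zero)) (suc zero) = refl
Bull-sym (suc (suc zero)) (suc (suc zero)) = refl
Bull-sym (suc (suc zero)) (suc (suc (suc zero))) = refl
Bull-sym (suc (suc zero)) (suc (suc (suc (suc zero)))) = refl
Bull-sym (suc (suc (suc zero))) zero = refl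
Bull-sym (suc (suc (suc zero))) (suc zero) = refl
Bull-sym (suc (suc (suc zero))) (suc (suc zero)) = refl
Bull-sym (suc (suc (suc zero))) (suc (suc (suc zero))) = refl
Bull-sym (suc (suc (suc zero))) (suc (suc (suc (suc zero)))) = refl
Bull-sym (suc (suc (suc (suc zero)))) zero = refl
Bull-sym (suc (suc (suc (suc zero)))) (suc zero) = refl
Bull-sym (suc (suc (suc (suc zero)))) (suc (suc zero)) = refl
Bull-sym (suc (suc (suc (suc zero)))) (suc (suc (suc zero))) = refl
Bull-sym (suc (suc (suc (suc zero)))) (suc (suc (suc (suc zero)))) = refl

Bull-irr : ∀ x → Bull-E x x ≡ false
Bull-irr zero = refl
Bull-irr (suc zero) = refl
Bull-irr (suc (suc zero)) = refl
Bull-irr (suc (suc (suc zero))) = refl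
Bull-irr (suc (suc (suc (suc zero)))) = refl

Bull : Graph
Bull = record { n = 5 ; E = Bull-E ; sym = Bull-sym ; irrefl = Bull-irr }

-- C5 on vertices 0..4, edges [(0, 1), (1, 2), (2, 3), (3, 4), (4, 0)]
C5-E : Fin 5 → Fin 5 → Bool
C5-E zero zero = false
C5-E zero (suc zero) = true
C5-E zero (suc (suc zero)) = false
C5-E zero (suc (suc (suc zero))) = false
C5-E zero (suc (suc (suc (suc zero)))) = true
C5-E (suc zero) zero = true
C5-E (suc zero) (suc zero) = false
C5-E (suc zero) (suc (suc zero)) = true
C5-E (suc zero) (suc (suc (suc zero))) = false
C5-E (suc zero) (suc (suc (suc (suc zero)))) = false
C5-E (suc (suc zero)) zero = false
C5-E (suc (suc zero)) (suc zero) = true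
C5-E (suc (suc zero)) (suc (suc zero)) = false
C5-E (suc (suc zero)) (suc (suc (suc zero))) = true
C5-E (suc (suc zero)) (suc (suc (suc (suc zero)))) = false
C5-E (suc (suc (suc zero))) zero = false
C5-E (suc (suc (suc zero))) (suc zero) = false
C5-E (suc (suc (suc zero))) (suc (suc zero)) = true
C5-E (suc (suc (suc zero))) (suc (suc (suc zero))) = false
C5-E (suc (suc (suc zero))) (suc (suc (suc (suc zero)))) = true
C5-E (suc (suc (suc (suc zero)))) zero = true
C5-E (suc (suc (suc (suc zero)))) (suc zero) = false
C5-E (suc (suc (suc (suc zero)))) (suc (suc zero)) = false
C5-E (suc (suc (suc (suc zero)))) (suc (suc (suc zero))) = true
C5-E (suc (suc (suc (suc zero)))) (suc (suc (suc (suc zero)))) = false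

C5-sym : ∀ x y → C5-E x y ≡ C5-E y x
C5-sym zero zero = refl
C5-sym zero (suc zero) = refl
C5-sym zero (suc (suc zero)) = refl
C5-sym zero (suc (suc (suc zero))) = refl
C5-sym zero (suc (suc (suc (suc zero)))) = refl
C5-sym (suc zero) zero = refl
C5-sym (suc zero) (suc zero) = refl
C5-sym (suc zero) (suc (suc zero)) = refl
C5-sym (suc zero) (suc (suc (suc zero))) = refl
C5-sym (suc zero) (suc (suc (suc (suc zero)))) = refl
C5-sym (suc (suc zero)) zero = refl
C5-sym (suc (suc zero)) (suc zero) = refl
C5-sym (suc (suc zero)) (suc (suc zero)) = refl
C5-sym (suc (suc zero)) (suc (suc (suc zero))) = refl
C5-sym (suc (suc zero)) (suc (suc (suc (suc zero)))) = refl
C5-sym (suc (suc (suc zero))) zero = refl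
C5-sym (suc (suc (suc zero))) (suc zero) = refl
C5-sym (suc (suc (suc zero))) (suc (suc zero)) = refl
C5-sym (suc (suc (suc zero))) (suc (suc (suc zero))) = refl
C5-sym (suc (suc (suc zero))) (suc (suc (suc (suc zero)))) = refl
C5-sym (suc (suc (suc (suc zero)))) zero = refl
C5-sym (suc (suc (suc (suc zero)))) (suc zero) = refl
C5-sym (suc (suc (suc (suc zero)))) (suc (suc zero)) = refl
C5-sym (suc (suc (suc (suc zero)))) (suc (suc (suc zero))) = refl
C5-sym (suc (suc (suc (suc zero)))) (suc (suc (suc (suc zero)))) = refl

C5-irr : ∀ x → C5-E x x ≡ false
C5-irr zero = refl
C5-irr (suc zero) = refl
C5-irr (suc (suc zero)) = refl
C5-irr (suc (suc (suc zero))) = refl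
C5-irr (suc (suc (suc (suc zero)))) = refl

C5 : Graph
C5 = record { n = 5 ; E = C5-E ; sym = C5-sym ; irrefl = C5-irr }

SwitchCograph : Graph → Set
SwitchCograph G =
  ¬ ContainsInduced G Gem × ¬ ContainsInduced G CoGem ×
  ¬ ContainsInduced G Bull × ¬ ContainsInduced G C5

module Submission where

-- Fix a
-- vertex x₀ and label every vertex by its adjacency to x₀.  Switching G along
-- this labelling (flipping the adjacency of every pair with different labels)
-- gives a graph H in which x₀ is isolated, and H is a cograph: an induced P4
-- of H together with x₀ would switch back to one of the four forbidden graphs
-- (a finite check over the 16 labellings of the P4).
--
-- A cograph splits every vertex set with two vertices into two parts with no
-- edges or all edges between them (CographDecomposition).  Switched back to
-- G, the edges between the parts only depend on the labels.  Along this
-- decomposition, LabelledColouring builds for every vertex set W cliques of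
-- label true, of label false and of any labels, of sizes a, b and g, such that
-- W can be coloured from every palette of tagged colours with room for a
-- colours on label true, b on label false and g in total.  Gluing colourings
-- of the two parts means splitting a palette between them; this is done one
-- colour at a time by the arithmetic of Demands and Palettes.  A palette of
-- g colours usable on both labels then yields a clique and a proper colouring
-- of the same size g, so χ(G) = ω(G).  As switch cographs form a hereditary
-- class, G is perfect.

-- The arithmetic behind splitting a palette between the two parts of a
-- composition: colours are handed out one at a time, each reducing the
-- demand of the part that receives it, while the demands keep fitting the
-- colours that are left.
module Demands where

  open import Data.Nat
  open import Data.Nat.Properties
  open import Data.Product using (Σ; _×_; _,_)
  open import Data.Sum using (_⊎_; inj₁; inj₂)
  open import Data.Empty using (⊥; ⊥-elim)
  open import Relation.Binary.PropositionalEquality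
  open import Data.Nat.Tactic.RingSolver

  -- A demand (p, r, q) is what a part of the graph still needs from a palette:
  -- needA = p + r colours usable on its label-true vertices, needB = r + q on
  -- its label-false vertices and needAll = p + r + q colours in total.
  record Demand : Set where
    constructor demand
    field onlyA shared onlyB : ℕ
  open Demand public

  needA : Demand → ℕ
  needA (demand p r q) = p + r
  needB : Demand → ℕ
  needB (demand p r q) = r + q
  needAll : Demand → ℕ
  needAll (demand p r q) = p + r + q

  needAll≡onlyA+needB : ∀ s → needAll s ≡ onlyA s + needB s
  needAll≡onlyA+needB (demand p r q) = +-assoc p r q

  needA≤needAll : ∀ s → needA s ≤ needAll s
  needA≤needAll (demand p r q) = m≤m+n (p + r) q

  needB≤needAll : ∀ s → needB s ≤ needAll s
  needB≤needAll s = subst (needB s ≤_) (sym (needAll≡onlyA+needB s)) (m≤n+m (needB s) (onlyA s))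

  onlyA≤needA : ∀ s → onlyA s ≤ needA s
  onlyA≤needA (demand p r q) = m≤m+n p r

  needAll≤needA+needB : ∀ s → needAll s ≤ needA s + needB s
  needAll≤needA+needB (demand p r q) = +-monoʳ-≤ (p + r) (m≤n+m q r)

  -- The ways a part can receive one colour: not at all, as a colour usable
  -- on label true only (A) or false only (B), or as a colour usable on both
  -- labels which is spent on the shared, the A-only or the B-only need.
  data Use : Set where
    skip useA useB useShared useSharedA useSharedB : Use

  -- Receiving an A-colour: it serves an A-only need, or else a shared need,
  -- which leaves a B-only need behind.
  takeA : Demand → Demand
  takeA (demand (suc p) r q) = demand p r q
  takeA (demand zero (suc r) q) = demand zero r (suc q)
  takeA (demand zero zero q) = demand zero zero q

  takeB : Demand → Demand
  takeB (demand p r (suc q)) = demand p r q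
  takeB (demand p (suc r) zero) = demand (suc p) r zero
  takeB (demand p zero zero) = demand p zero zero

  takeShared : Demand → Demand
  takeShared (demand p (suc r) q) = demand p r q
  takeShared (demand p zero q) = demand p zero q

  takeSharedA : Demand → Demand
  takeSharedA (demand (suc p) r q) = demand p r q
  takeSharedA (demand zero r q) = demand zero r q

  takeSharedB : Demand → Demand
  takeSharedB (demand p r (suc q)) = demand p r q
  takeSharedB (demand p r zero) = demand p r zero

  after : Use → Demand → Demand
  after skip s = s
  after useA s = takeA s
  after useB s = takeB s
  after useShared s = takeShared s
  after useSharedA s = takeSharedA s
  after useSharedB s = takeSharedB s

  record Shrinks (s s' : Demand) : Set where
    field
      A↓ : needA s' ≤ needA s
      B↓ : needB s' ≤ needB s
      All↓ : needAll s' ≤ needAll s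

  shrinks : ∀ o s → Shrinks s (after o s)
  shrinks skip s = record { A↓ = ≤-refl ; B↓ = ≤-refl ; All↓ = ≤-refl }
  shrinks useA (demand (suc p) r q) = record { A↓ = n≤1+n _ ; B↓ = ≤-refl ; All↓ = n≤1+n _ }
  shrinks useA (demand zero (suc r) q) =
    record { A↓ = n≤1+n _
      ; B↓ = ≤-reflexive (+-suc r q)
      ; All↓ = ≤-reflexive (+-suc r q) }
  shrinks useA (demand zero zero q) = record { A↓ = ≤-refl ; B↓ = ≤-refl ; All↓ = ≤-refl }
  shrinks useB (demand p r (suc q)) =
    record { A↓ = ≤-refl ; B↓ = ≤-trans (n≤1+n _) (≤-reflexive (sym (+-suc r q))) ; All↓ = ≤-trans (n≤1+n _)
        (≤-reflexive (sym (+-suc (p + r) q))) }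
  shrinks useB (demand p (suc r) zero) =
    record { A↓ = ≤-reflexive (sym (+-suc p r))
      ; B↓ = n≤1+n _
      ; All↓ = ≤-reflexive (cong (_+ 0) (sym (+-suc p r))) }
  shrinks useB (demand p zero zero) = record { A↓ = ≤-refl ; B↓ = ≤-refl ; All↓ = ≤-refl }
  shrinks useShared (demand p (suc r) q) =
    record { A↓ = +-monoʳ-≤ p (n≤1+n r)
      ; B↓ = n≤1+n _
      ; All↓ = +-monoˡ-≤ q (+-monoʳ-≤ p (n≤1+n r)) }
  shrinks useShared (demand p zero q) = record { A↓ = ≤-refl ; B↓ = ≤-refl ; All↓ = ≤-refl }
  shrinks useSharedA (demand (suc p) r q) = record { A↓ = n≤1+n _ ; B↓ = ≤-refl ; All↓ = n≤1+n _ }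
  shrinks useSharedA (demand zero r q) = record { A↓ = ≤-refl ; B↓ = ≤-refl ; All↓ = ≤-refl }
  shrinks useSharedB (demand p r (suc q)) =
    record { A↓ = ≤-refl
      ; B↓ = +-monoʳ-≤ r (n≤1+n q)
      ; All↓ = +-monoʳ-≤ (p + r) (n≤1+n q) }
  shrinks useSharedB (demand p r zero) = record { A↓ = ≤-refl ; B↓ = ≤-refl ; All↓ = ≤-refl }

  takeA-needA< : ∀ s → 0 < needA s → needA (takeA s) < needA s
  takeA-needA< (demand (suc p) r q) _ = ≤-refl
  takeA-needA< (demand zero (suc r) q) _ = ≤-refl
  takeA-needA< (demand zero zero q) ()

  takeA-needAll< : ∀ s → 0 < onlyA s → needAll (takeA s) < needAll s
  takeA-needAll< (demand (suc p) r q) _ = ≤-refl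

  takeB-needB< : ∀ s → 0 < needB s → needB (takeB s) < needB s
  takeB-needB< (demand p r (suc q)) _ = ≤-reflexive (sym (+-suc r q))
  takeB-needB< (demand p (suc r) zero) _ = ≤-refl
  takeB-needB< (demand p zero zero) ()

  takeB-needAll< : ∀ s → 0 < onlyB s → needAll (takeB s) < needAll s
  takeB-needAll< (demand p r (suc q)) _ = ≤-reflexive (sym (+-suc (p + r) q))

  takeShared-needA< : ∀ s → 0 < shared s → needA (takeShared s) < needA s
  takeShared-needA< (demand p (suc r) q) _ = ≤-reflexive (sym (+-suc p r))
  takeShared-needB< : ∀ s → 0 < shared s → needB (takeShared s) < needB s
  takeShared-needB< (demand p (suc r) q) _ = ≤-refl
  takeShared-needAll< : ∀ s → 0 < shared s → needAll (takeShared s) < needAll s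
  takeShared-needAll< (demand p (suc r) q) _ = ≤-reflexive (cong (_+ q) (sym (+-suc p r)))

  takeSharedA-needA< : ∀ s → 0 < onlyA s → needA (takeSharedA s) < needA s
  takeSharedA-needA< (demand (suc p) r q) _ = ≤-refl
  takeSharedA-needAll< : ∀ s → 0 < onlyA s → needAll (takeSharedA s) < needAll s
  takeSharedA-needAll< (demand (suc p) r q) _ = ≤-refl

  takeSharedB-needB< : ∀ s → 0 < onlyB s → needB (takeSharedB s) < needB s
  takeSharedB-needB< (demand p r (suc q)) _ = ≤-reflexive (sym (+-suc r q))
  takeSharedB-needAll< : ∀ s → 0 < onlyB s → needAll (takeSharedB s) < needAll s
  takeSharedB-needAll< (demand p r (suc q)) _ = ≤-reflexive (sym (+-suc (p + r) q))

  costA : Use → ℕ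
  costA skip = 0
  costA useA = 1
  costA useB = 0
  costA useShared = 1
  costA useSharedA = 1
  costA useSharedB = 1

  costB : Use → ℕ
  costB skip = 0
  costB useA = 0
  costB useB = 1
  costB useShared = 1
  costB useSharedA = 1
  costB useSharedB = 1

  costAll : Use → ℕ
  costAll skip = 0
  costAll _ = 1

  record Accounted (o : Use) (s : Demand) : Set where
    field
      A-paid : needA s ≤ costA o + needA (after o s)
      B-paid : needB s ≤ costB o + needB (after o s)
      All-paid : needAll s ≤ costAll o + needAll (after o s)

  accounted : ∀ o s → Accounted o s
  accounted skip s = record { A-paid = ≤-refl ; B-paid = ≤-refl ; All-paid = ≤-refl }
  accounted useA (demand (suc p) r q) = record { A-paid = ≤-refl ; B-paid = ≤-refl ; All-paid = ≤-refl }
  accounted useA (demand zero (suc r) q) =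
    record { A-paid = ≤-refl
      ; B-paid = ≤-reflexive (sym (+-suc r q))
      ; All-paid = m≤n⇒m≤1+n (≤-reflexive (sym (+-suc r q))) }
  accounted useA (demand zero zero q) = record { A-paid = z≤n ; B-paid = ≤-refl ; All-paid = m≤n⇒m≤1+n ≤-refl }
  accounted useB (demand p r (suc q)) =
    record { A-paid = ≤-refl
      ; B-paid = ≤-reflexive (+-suc r q)
      ; All-paid = ≤-reflexive (+-suc (p + r) q) }
  accounted useB (demand p (suc r) zero) =
    record { A-paid = ≤-reflexive (+-suc p r)
      ; B-paid = ≤-refl
      ; All-paid = m≤n⇒m≤1+n (≤-reflexive (cong (_+ 0) (+-suc p r))) }
  accounted useB (demand p zero zero) = record { A-paid = ≤-refl ; B-paid = z≤n ; All-paid = m≤n⇒m≤1+n ≤-refl }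
  accounted useShared (demand p (suc r) q) =
    record { A-paid = ≤-reflexive (+-suc p r)
      ; B-paid = ≤-refl
      ; All-paid = ≤-reflexive (cong (_+ q) (+-suc p r)) }
  accounted useShared (demand p zero q) =
    record { A-paid = m≤n⇒m≤1+n ≤-refl
      ; B-paid = m≤n⇒m≤1+n ≤-refl
      ; All-paid = m≤n⇒m≤1+n ≤-refl }
  accounted useSharedA (demand (suc p) r q) = record { A-paid = ≤-refl ; B-paid = m≤n⇒m≤1+n ≤-refl ; All-paid = ≤-refl }
  accounted useSharedA (demand zero r q) =
    record { A-paid = m≤n⇒m≤1+n ≤-refl
      ; B-paid = m≤n⇒m≤1+n ≤-refl
      ; All-paid = m≤n⇒m≤1+n ≤-refl }
  accounted useSharedB (demand p r (suc q)) =
    record { A-paid = m≤n⇒m≤1+n ≤-refl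
      ; B-paid = ≤-reflexive (+-suc r q)
      ; All-paid = ≤-reflexive (+-suc (p + r) q) }
  accounted useSharedB (demand p r zero) =
    record { A-paid = m≤n⇒m≤1+n ≤-refl
      ; B-paid = m≤n⇒m≤1+n ≤-refl
      ; All-paid = m≤n⇒m≤1+n ≤-refl }

  shrink-below : ∀ {x x' k} → x ≤ suc k → (0 < x → x' < x) → x' ≤ x → x' ≤ k
  shrink-below {zero} _ _ x'≤0 = ≤-trans x'≤0 z≤n
  shrink-below {suc x} (s≤s x≤k) d _ = ≤-trans (≤-pred (d z<s)) x≤k

  <-below : ∀ {x x' k} → x ≤ suc k → x' < x → x' ≤ k
  <-below x≤ x'< = ≤-pred (≤-trans x'< x≤)

  r+q≤p+r+q : ∀ p r q → r + q ≤ p + r + q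
  r+q≤p+r+q p r q = ≤-trans (m≤n+m (r + q) p) (≤-reflexive (sym (+-assoc p r q)))

  p+r≤p+r+q : ∀ p r q → p + r ≤ p + r + q
  p+r≤p+r+q p r q = m≤m+n (p + r) q

  takeA-fitsA : ∀ s {k} → needA s ≤ suc k → needA (takeA s) ≤ k
  takeA-fitsA s h = shrink-below h (takeA-needA< s) (Shrinks.A↓ (shrinks useA s))

  takeA-fitsAll : ∀ s {k} → needAll s ≤ suc k → needB s ≤ k → needAll (takeA s) ≤ k
  takeA-fitsAll (demand (suc p) r q) h _ = ≤-pred h
  takeA-fitsAll (demand zero r q) h hb = ≤-trans (Shrinks.All↓ (shrinks useA (demand zero r q))) hb

  takeA-fitsMixed : ∀ s {k x} → needA s + x ≤ suc k → x ≤ k → needA (takeA s) + x ≤ k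
  takeA-fitsMixed s {k} {x} h hx with needA s in eq
  ... | zero = ≤-trans (+-monoˡ-≤ x (subst (needA (takeA s) ≤_) eq (Shrinks.A↓ (shrinks useA s)))) hx
  ... | suc y = ≤-pred (≤-trans (+-monoˡ-≤ x (subst (needA (takeA s) <_) eq (takeA-needA< s (subst (0 <_) (sym eq) z<s)))) h)

  takeB-fitsB : ∀ s {k} → needB s ≤ suc k → needB (takeB s) ≤ k
  takeB-fitsB s h = shrink-below h (takeB-needB< s) (Shrinks.B↓ (shrinks useB s))

  takeB-fitsAll : ∀ s {k} → needAll s ≤ suc k → needA s ≤ k → needAll (takeB s) ≤ k
  takeB-fitsAll (demand p r (suc q)) h _ = ≤-pred (≤-trans (≤-reflexive (sym (+-suc (p + r) q))) h)
  takeB-fitsAll (demand p r zero) h ha = ≤-trans (Shrinks.All↓ (shrinks useB (demand p r zero)))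
      (≤-trans (≤-reflexive (+-identityʳ (p + r))) ha)

  takeB-fitsMixed : ∀ s {k x} → x + needB s ≤ suc k → x ≤ k → x + needB (takeB s) ≤ k
  takeB-fitsMixed s {k} {x} h hx with needB s in eq
  ... | zero = ≤-trans (+-monoʳ-≤ x (subst (needB (takeB s) ≤_) eq (Shrinks.B↓ (shrinks useB s))))
      (≤-trans (≤-reflexive (+-identityʳ x)) hx)
  ... | suc y = ≤-pred (≤-trans (≤-reflexive (sym (+-suc x (needB (takeB s)))))
      (≤-trans (+-monoʳ-≤ x (subst (needB (takeB s) <_) eq (takeB-needB< s (subst (0 <_) (sym eq) z<s)))) h))

  -- The demands of the two parts of a union fit a palette with p A-colours, r
  -- shared and q B-colours: each part's needs fit, and so does an A-clique of
  -- one part together with a B-clique of the other.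
  record UnionFits (s1 s2 : Demand) (p r q : ℕ) : Set where
    field
      a₁≤ : needA s1 ≤ p + r
      a₂≤ : needA s2 ≤ p + r
      b₁≤ : needB s1 ≤ r + q
      b₂≤ : needB s2 ≤ r + q
      g₁≤ : needAll s1 ≤ p + r + q
      g₂≤ : needAll s2 ≤ p + r + q
      a₁b₂≤ : needA s1 + needB s2 ≤ p + r + q
      a₂b₁≤ : needA s2 + needB s1 ≤ p + r + q

  unionFits-takeA : ∀ {s1 s2 p r q} → UnionFits s1 s2 (suc p) r q → UnionFits (takeA s1) (takeA s2) p r q
  unionFits-takeA {s1} {s2} {p} {r} {q} h = record
    { a₁≤ = takeA-fitsA s1 a₁≤
    ; a₂≤ = takeA-fitsA s2 a₂≤
    ; b₁≤ = ≤-trans (Shrinks.B↓ (shrinks useA s1)) b₁≤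
    ; b₂≤ = ≤-trans (Shrinks.B↓ (shrinks useA s2)) b₂≤
    ; g₁≤ = takeA-fitsAll s1 g₁≤ (≤-trans b₁≤ (r+q≤p+r+q p r q))
    ; g₂≤ = takeA-fitsAll s2 g₂≤ (≤-trans b₂≤ (r+q≤p+r+q p r q))
    ; a₁b₂≤ = ≤-trans (+-monoʳ-≤ (needA (takeA s1)) (Shrinks.B↓ (shrinks useA s2)))
        (takeA-fitsMixed s1 a₁b₂≤ (≤-trans b₂≤ (r+q≤p+r+q p r q)))
    ; a₂b₁≤ = ≤-trans (+-monoʳ-≤ (needA (takeA s2)) (Shrinks.B↓ (shrinks useA s1)))
        (takeA-fitsMixed s2 a₂b₁≤ (≤-trans b₁≤ (r+q≤p+r+q p r q)))
    }
    where open UnionFits h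

  ≤+suc : ∀ {x} a b → x ≤ a + suc b → x ≤ suc (a + b)
  ≤+suc a b h = ≤-trans h (≤-reflexive (+-suc a b))

  unionFits-takeB : ∀ {s1 s2 p r q} → UnionFits s1 s2 p r (suc q) → UnionFits (takeB s1) (takeB s2) p r q
  unionFits-takeB {s1} {s2} {p} {r} {q} h = record
    { a₁≤ = ≤-trans (Shrinks.A↓ (shrinks useB s1)) a₁≤
    ; a₂≤ = ≤-trans (Shrinks.A↓ (shrinks useB s2)) a₂≤
    ; b₁≤ = takeB-fitsB s1 (≤+suc r q b₁≤)
    ; b₂≤ = takeB-fitsB s2 (≤+suc r q b₂≤)
    ; g₁≤ = takeB-fitsAll s1 (≤+suc (p + r) q g₁≤) (≤-trans a₁≤ (p+r≤p+r+q p r q))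
    ; g₂≤ = takeB-fitsAll s2 (≤+suc (p + r) q g₂≤) (≤-trans a₂≤ (p+r≤p+r+q p r q))
    ; a₁b₂≤ = ≤-trans (+-monoˡ-≤ (needB (takeB s2)) (Shrinks.A↓ (shrinks useB s1)))
        (takeB-fitsMixed s2 (≤+suc (p + r) q a₁b₂≤) (≤-trans a₁≤ (p+r≤p+r+q p r q)))
    ; a₂b₁≤ = ≤-trans (+-monoˡ-≤ (needB (takeB s1)) (Shrinks.A↓ (shrinks useB s2)))
        (takeB-fitsMixed s1 (≤+suc (p + r) q a₂b₁≤) (≤-trans a₂≤ (p+r≤p+r+q p r q)))
    }
    where open UnionFits h

  takeAs : ℕ → Demand → Demand
  takeAs zero s = s
  takeAs (suc k) s = takeAs k (takeA s)

  takeBs : ℕ → Demand → Demand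
  takeBs zero s = s
  takeBs (suc k) s = takeBs k (takeB s)

  unionFits-takeAs : ∀ p {s1 s2 r q} → UnionFits s1 s2 p r q → UnionFits (takeAs p s1) (takeAs p s2) 0 r q
  unionFits-takeAs zero h = h
  unionFits-takeAs (suc p) h = unionFits-takeAs p (unionFits-takeA h)

  unionFits-takeBs : ∀ q {s1 s2 r} → UnionFits s1 s2 0 r q → UnionFits (takeBs q s1) (takeBs q s2) 0 r 0
  unionFits-takeBs zero h = h
  unionFits-takeBs (suc q) h = unionFits-takeBs q (unionFits-takeB h)

  record Paid (s s' : Demand) (x y z : ℕ) : Set where
    field
      A-paid : needA s ≤ x + needA s'
      B-paid : needB s ≤ y + needB s'
      All-paid : needAll s ≤ z + needAll s'

  paid-takeAs : ∀ p s → Paid s (takeAs p s) p 0 p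
  paid-takeAs zero s = record { A-paid = ≤-refl ; B-paid = ≤-refl ; All-paid = ≤-refl }
  paid-takeAs (suc p) s = record
    { A-paid = ≤-trans (Accounted.A-paid so) (s≤s (Paid.A-paid ih))
    ; B-paid = ≤-trans (Accounted.B-paid so) (Paid.B-paid ih)
    ; All-paid = ≤-trans (Accounted.All-paid so) (s≤s (Paid.All-paid ih)) }
    where so = accounted useA s
          ih = paid-takeAs p (takeA s)

  paid-takeBs : ∀ q s → Paid s (takeBs q s) 0 q q
  paid-takeBs zero s = record { A-paid = ≤-refl ; B-paid = ≤-refl ; All-paid = ≤-refl }
  paid-takeBs (suc q) s = record
    { A-paid = ≤-trans (Accounted.A-paid so) (Paid.A-paid ih)
    ; B-paid = ≤-trans (Accounted.B-paid so) (s≤s (Paid.B-paid ih))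
    ; All-paid = ≤-trans (Accounted.All-paid so) (s≤s (Paid.All-paid ih)) }
    where so = accounted useB s
          ih = paid-takeBs q (takeB s)

  record SharedUnionFits (s1 s2 : Demand) (r : ℕ) : Set where
    field
      g₁≤ : needAll s1 ≤ r
      g₂≤ : needAll s2 ≤ r
      a₁b₂≤ : needA s1 + needB s2 ≤ r
      a₂b₁≤ : needA s2 + needB s1 ≤ r

  unionFits⇒shared : ∀ {s1 s2 r} → UnionFits s1 s2 0 r 0 → SharedUnionFits s1 s2 r
  unionFits⇒shared {s1} {s2} {r} h = record
    { g₁≤ = subst (needAll s1 ≤_) (+-identityʳ r) g₁≤
    ; g₂≤ = subst (needAll s2 ≤_) (+-identityʳ r) g₂≤
    ; a₁b₂≤ = subst (_ ≤_) (+-identityʳ r) a₁b₂≤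
    ; a₂b₁≤ = subst (_ ≤_) (+-identityʳ r) a₂b₁≤ }
    where open UnionFits h

  data SharedUse : Set where
    forBoth forA forB : SharedUse

  sharedUse : SharedUse → Use
  sharedUse forBoth = useShared
  sharedUse forA = useSharedA
  sharedUse forB = useSharedB

  -- How one shared colour is handed out in a union: to both parts as an
  -- A-colour, to both as a B-colour, or to just one of the parts.
  data UnionMove : Set where
    bothA bothB : UnionMove
    first second : SharedUse → UnionMove

  unionUse₁ : UnionMove → Use
  unionUse₁ bothA = useA
  unionUse₁ bothB = useB
  unionUse₁ (first o) = sharedUse o
  unionUse₁ (second o) = skip

  unionUse₂ : UnionMove → Use
  unionUse₂ bothA = useA
  unionUse₂ bothB = useB
  unionUse₂ (first o) = skip
  unionUse₂ (second o) = sharedUse o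

  Settles : ℕ → ℕ → ℕ → Set
  Settles x x' r = x ≤ r ⊎ x' < x

  settles : ∀ {x x' r} → x' ≤ x → x ≤ suc r → Settles x x' r → x' ≤ r
  settles m _ (inj₁ sl) = ≤-trans m sl
  settles m h (inj₂ d) = <-below h d

  sharedUnionFits-after : ∀ {s1 s2 r} o1 o2 → SharedUnionFits s1 s2 (suc r)
       → Settles (needAll s1) (needAll (after o1 s1)) r
       → Settles (needAll s2) (needAll (after o2 s2)) r
       → Settles (needA s1 + needB s2) (needA (after o1 s1) + needB (after o2 s2)) r
       → Settles (needA s2 + needB s1) (needA (after o2 s2) + needB (after o1 s1)) r
       → SharedUnionFits (after o1 s1) (after o2 s2) r
  sharedUnionFits-after {s1} {s2} o1 o2 h d1 d2 dx dy = record
    { g₁≤ = settles (Shrinks.All↓ m1) g₁≤ d1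
    ; g₂≤ = settles (Shrinks.All↓ m2) g₂≤ d2
    ; a₁b₂≤ = settles (+-mono-≤ (Shrinks.A↓ m1) (Shrinks.B↓ m2)) a₁b₂≤ dx
    ; a₂b₁≤ = settles (+-mono-≤ (Shrinks.A↓ m2) (Shrinks.B↓ m1)) a₂b₁≤ dy }
    where open SharedUnionFits h
          m1 = shrinks o1 s1
          m2 = shrinks o2 s2

  ≤suc⇒≤⊎≡ : ∀ {x r} → x ≤ suc r → x ≤ r ⊎ x ≡ suc r
  ≤suc⇒≤⊎≡ h with m≤n⇒m<n∨m≡n h
  ... | inj₁ lt = inj₁ (≤-pred lt)
  ... | inj₂ eq = inj₂ eq

  sharedUnionFits-swap : ∀ {s1 s2 r} → SharedUnionFits s1 s2 r → SharedUnionFits s2 s1 r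
  sharedUnionFits-swap h = record { g₁≤ = g₂≤ ; g₂≤ = g₁≤ ; a₁b₂≤ = a₂b₁≤ ; a₂b₁≤ = a₁b₂≤ }
    where open SharedUnionFits h

  UnionStep : Demand → Demand → ℕ → Set
  UnionStep s1 s2 r = Σ UnionMove λ ρ → SharedUnionFits (after (unionUse₁ ρ) s1) (after (unionUse₂ ρ) s2) r

  unionStep-swap : ∀ {s1 s2 r} → UnionStep s2 s1 r → UnionStep s1 s2 r
  unionStep-swap (bothA , h) = bothA , sharedUnionFits-swap h
  unionStep-swap (bothB , h) = bothB , sharedUnionFits-swap h
  unionStep-swap (first o , h) = second o , sharedUnionFits-swap h
  unionStep-swap (second o , h) = first o , sharedUnionFits-swap h

  ≡suc⇒pos : ∀ {x y} → x ≡ suc y → 0 < x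
  ≡suc⇒pos refl = z<s

  ≡suc⇒≰ : ∀ {x r} → x ≡ suc r → x ≤ r → ⊥
  ≡suc⇒≰ refl h = 1+n≰n h

  unionStep-oneTight-noShared : ∀ P1 Q1 s2 r → SharedUnionFits (demand P1 zero Q1) s2 (suc r) →
    needAll (demand P1 zero Q1) ≡ suc r → needAll s2 ≤ r → UnionStep (demand P1 zero Q1) s2 r
  unionStep-oneTight-noShared P1 Q1 s2 r h t1 s2l with ≤suc⇒≤⊎≡ (SharedUnionFits.a₁b₂≤ h) | ≤suc⇒≤⊎≡
      (SharedUnionFits.a₂b₁≤ h)
  unionStep-oneTight-noShared (suc P1) Q1 s2 r h t1 s2l | inj₂ tx | inj₂ ty =
    bothA , sharedUnionFits-after useA useA h (inj₂ (takeA-needAll< s1 z<s)) (inj₁ s2l)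
            (inj₂ (+-mono-<-≤ (takeA-needA< s1 z<s) (Shrinks.B↓ (shrinks useA s2))))
            (inj₂ (+-mono-<-≤ (takeA-needA< s2 a2pos) (Shrinks.B↓ (shrinks useA s1))))
    where
      s1 = demand (suc P1) zero Q1
      eq : needA s2 + Q1 ≡ suc P1 + 0 + Q1
      eq = trans ty (sym t1)
      a2pos : 0 < needA s2
      a2pos = subst (0 <_) (sym (+-cancelʳ-≡ Q1 (needA s2) (suc P1 + 0) eq)) z<s
  unionStep-oneTight-noShared zero Q1 s2 r h t1 s2l | inj₂ tx | inj₂ ty =
    bothB , sharedUnionFits-after useB useB h (inj₂ (takeB-needAll< s1 (≡suc⇒pos t1))) (inj₁ s2l)
            (inj₂ (+-mono-≤-< (Shrinks.A↓ (shrinks useB s1)) (takeB-needB< s2 (≡suc⇒pos tx))))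
            (inj₂ (+-mono-≤-< (Shrinks.A↓ (shrinks useB s2)) (takeB-needB< s1 (≡suc⇒pos t1))))
    where s1 = demand zero zero Q1
  unionStep-oneTight-noShared (suc P1) Q1 s2 r h t1 s2l | inj₂ tx | inj₁ ys =
    first forA , sharedUnionFits-after useSharedA skip h (inj₂ (takeSharedA-needAll< s1 z<s)) (inj₁ s2l)
               (inj₂ (+-mono-<-≤ (takeSharedA-needA< s1 z<s) ≤-refl)) (inj₁ ys)
    where s1 = demand (suc P1) zero Q1
  unionStep-oneTight-noShared zero Q1 s2 r h t1 s2l | inj₂ tx | inj₁ ys =
    ⊥-elim (≡suc⇒≰ tx (≤-trans (needB≤needAll s2) s2l))
  unionStep-oneTight-noShared P1 (suc Q1) s2 r h t1 s2l | inj₁ xs | inj₂ ty =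
    first forB , sharedUnionFits-after useSharedB skip h (inj₂ (takeSharedB-needAll< s1 z<s)) (inj₁ s2l) (inj₁ xs)
               (inj₂ (+-mono-≤-< ≤-refl (takeSharedB-needB< s1 z<s)))
    where s1 = demand P1 zero (suc Q1)
  unionStep-oneTight-noShared P1 zero s2 r h t1 s2l | inj₁ xs | inj₂ ty =
    ⊥-elim (≡suc⇒≰ (trans (sym (+-identityʳ (needA s2))) ty) (≤-trans (needA≤needAll s2) s2l))
  unionStep-oneTight-noShared (suc P1) Q1 s2 r h t1 s2l | inj₁ xs | inj₁ ys =
    first forA , sharedUnionFits-after useSharedA skip h (inj₂ (takeSharedA-needAll< s1 z<s)) (inj₁ s2l) (inj₁ xs) (inj₁ ys)
    where s1 = demand (suc P1) zero Q1
  unionStep-oneTight-noShared zero Q1 s2 r h t1 s2l | inj₁ xs | inj₁ ys =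
    first forB , sharedUnionFits-after useSharedB skip h (inj₂ (takeSharedB-needAll< s1 (≡suc⇒pos t1))) (inj₁ s2l)
        (inj₁ xs) (inj₁ ys)
    where s1 = demand zero zero Q1

  unionStep-oneTight : ∀ s1 s2 r → SharedUnionFits s1 s2 (suc r) → needAll s1 ≡ suc r → needAll s2 ≤ r → UnionStep s1 s2 r
  unionStep-oneTight (demand P1 (suc R1) Q1) s2 r h t1 s2l =
    first forBoth , sharedUnionFits-after useShared skip h (inj₂ (takeShared-needAll< s1 z<s)) (inj₁ s2l)
                   (inj₂ (+-mono-<-≤ (takeShared-needA< s1 z<s) ≤-refl))
                   (inj₂ (+-mono-≤-< ≤-refl (takeShared-needB< s1 z<s)))
    where s1 = demand P1 (suc R1) Q1
  unionStep-oneTight (demand P1 zero Q1) s2 r h t1 s2l = unionStep-oneTight-noShared P1 Q1 s2 r h t1 s2l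

  zero⊎pos : ∀ n → n ≡ 0 ⊎ 0 < n
  zero⊎pos zero = inj₁ refl
  zero⊎pos (suc n) = inj₂ z<s

  pos+≰ : ∀ {x y} → 0 < x → x + y ≤ y → ⊥
  pos+≰ {suc x} {y} _ h = 1+n≰n (≤-trans (s≤s (m≤n+m y x)) h)

  -- Union step when both parts need all remaining colours and the first has an
  -- A-need: then tightness forces A-only needs on both sides, and the colour
  -- goes to both parts as an A-colour.
  unionStep-bothTight-needA : ∀ s1 s2 r → SharedUnionFits s1 s2
      (suc r) → needAll s1 ≡ suc r → needAll s2 ≡ suc r → 0 < needA s1 → UnionStep s1 s2 r
  unionStep-bothTight-needA s1 s2 r h t1 t2 a1pos =
    bothA , sharedUnionFits-after useA useA h (inj₂ (takeA-needAll< s1 P1pos)) (inj₂ (takeA-needAll< s2 P2pos))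
            (inj₂ (+-mono-<-≤ (takeA-needA< s1 a1pos) (Shrinks.B↓ (shrinks useA s2))))
            (inj₂ (+-mono-<-≤ (takeA-needA< s2 a2pos) (Shrinks.B↓ (shrinks useA s1))))
    where
      open SharedUnionFits h
      D1 : needA s1 ≤ onlyA s2
      D1 = +-cancelʳ-≤ (needB s2) (needA s1) (onlyA s2)
          (≤-trans a₁b₂≤ (≤-reflexive (trans (sym t2) (needAll≡onlyA+needB s2))))
      P2pos : 0 < onlyA s2
      P2pos = <-≤-trans a1pos D1
      a2pos : 0 < needA s2
      a2pos = <-≤-trans P2pos (onlyA≤needA s2)
      D2 : needA s2 ≤ onlyA s1
      D2 = +-cancelʳ-≤ (needB s1) (needA s2) (onlyA s1)
          (≤-trans a₂b₁≤ (≤-reflexive (trans (sym t1) (needAll≡onlyA+needB s1))))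
      P1pos : 0 < onlyA s1
      P1pos = <-≤-trans a2pos D2

  unionStep-bothTight : ∀ s1 s2 r → SharedUnionFits s1 s2
      (suc r) → needAll s1 ≡ suc r → needAll s2 ≡ suc r → UnionStep s1 s2 r
  unionStep-bothTight (demand zero zero Q1) (demand zero zero Q2) r h t1 t2 =
    bothB , sharedUnionFits-after useB useB h (inj₂ (takeB-needAll< s1 (≡suc⇒pos t1)))
        (inj₂ (takeB-needAll< s2 (≡suc⇒pos t2)))
            (inj₂ (+-mono-≤-< (Shrinks.A↓ (shrinks useB s1)) (takeB-needB< s2 (≡suc⇒pos t2))))
            (inj₂ (+-mono-≤-< (Shrinks.A↓ (shrinks useB s2)) (takeB-needB< s1 (≡suc⇒pos t1))))
    where s1 = demand zero zero Q1
          s2 = demand zero zero Q2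
  unionStep-bothTight (demand zero zero Q1) (demand (suc P2) R2 Q2) r h t1 t2 =
    ⊥-elim (pos+≰ {suc P2 + R2} {Q1} z<s (≤-trans (SharedUnionFits.a₂b₁≤ h) (≤-reflexive (sym t1))))
  unionStep-bothTight (demand zero zero Q1) (demand zero (suc R2) Q2) r h t1 t2 =
    ⊥-elim (pos+≰ {suc R2} {Q1} z<s (≤-trans (SharedUnionFits.a₂b₁≤ h) (≤-reflexive (sym t1))))
  unionStep-bothTight (demand (suc P1) R1 Q1) s2 r h t1 t2 = unionStep-bothTight-needA _ s2 r h t1 t2 z<s
  unionStep-bothTight (demand zero (suc R1) Q1) s2 r h t1 t2 = unionStep-bothTight-needA _ s2 r h t1 t2 z<s

  unionStep-noneTight : ∀ s1 s2 r → SharedUnionFits s1 s2 (suc r) → needAll s1 ≤ r → needAll s2 ≤ r → UnionStep s1 s2 r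
  unionStep-noneTight s1 s2 r h s1l s2l = bothA , sharedUnionFits-after useA useA h (inj₁ s1l) (inj₁ s2l) dx dy
    where
      open SharedUnionFits h
      dx : Settles (needA s1 + needB s2) (needA (takeA s1) + needB (takeA s2)) r
      dx with ≤suc⇒≤⊎≡ a₁b₂≤
      ... | inj₁ sl = inj₁ sl
      ... | inj₂ tx with zero⊎pos (needA s1)
      ...   | inj₂ a1pos = inj₂ (+-mono-<-≤ (takeA-needA< s1 a1pos) (Shrinks.B↓ (shrinks useA s2)))
      ...   | inj₁ a1z = ⊥-elim (≡suc⇒≰ (trans (cong (_+ needB s2) (sym a1z)) tx) (≤-trans (needB≤needAll s2) s2l))
      dy : Settles (needA s2 + needB s1) (needA (takeA s2) + needB (takeA s1)) r
      dy with ≤suc⇒≤⊎≡ a₂b₁≤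
      ... | inj₁ sl = inj₁ sl
      ... | inj₂ ty with zero⊎pos (needA s2)
      ...   | inj₂ a2pos = inj₂ (+-mono-<-≤ (takeA-needA< s2 a2pos) (Shrinks.B↓ (shrinks useA s1)))
      ...   | inj₁ a2z = ⊥-elim (≡suc⇒≰ (trans (cong (_+ needB s1) (sym a2z)) ty) (≤-trans (needB≤needAll s1) s1l))

  unionStep : ∀ s1 s2 r → SharedUnionFits s1 s2 (suc r) → UnionStep s1 s2 r
  unionStep s1 s2 r h with ≤suc⇒≤⊎≡ (SharedUnionFits.g₁≤ h) | ≤suc⇒≤⊎≡ (SharedUnionFits.g₂≤ h)
  ... | inj₂ t1 | inj₂ t2 = unionStep-bothTight s1 s2 r h t1 t2
  ... | inj₂ t1 | inj₁ l2 = unionStep-oneTight s1 s2 r h t1 l2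
  ... | inj₁ l1 | inj₂ t2 = unionStep-swap (unionStep-oneTight s2 s1 r (sharedUnionFits-swap h) t2 l1)
  ... | inj₁ l1 | inj₁ l2 = unionStep-noneTight s1 s2 r h l1 l2

  -- The demands of the two parts of a join fit a palette with p A-colours, r
  -- shared and q B-colours: the A-cliques of both parts together fit the
  -- label-true colours, the B-cliques together the label-false colours, and
  -- each part fits the whole palette.
  record JoinFits (s1 s2 : Demand) (p r q : ℕ) : Set where
    field
      a₁+a₂≤ : needA s1 + needA s2 ≤ p + r
      b₁+b₂≤ : needB s1 + needB s2 ≤ r + q
      g₁≤ : needAll s1 ≤ p + r + q
      g₂≤ : needAll s2 ≤ p + r + q

  joinFits-swap : ∀ {s1 s2 p r q} → JoinFits s1 s2 p r q → JoinFits s2 s1 p r q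
  joinFits-swap {s1} {s2} {p} {r} {q} h = record
    { a₁+a₂≤ = subst (_≤ p + r) (+-comm (needA s1) (needA s2)) a₁+a₂≤
    ; b₁+b₂≤ = subst (_≤ r + q) (+-comm (needB s1) (needB s2)) b₁+b₂≤
    ; g₁≤ = g₂≤ ; g₂≤ = g₁≤ }
    where open JoinFits h

  needAll+shared : ∀ s1 s2 → needAll s1 + needAll s2 + (shared s1 + shared s2) ≡ (needA s1 + needA s2) +
      (needB s1 + needB s2)
  needAll+shared (demand p1 r1 q1) (demand p2 r2 q2) = lem p1 r1 q1 p2 r2 q2
    where
      lem : ∀ p1 r1 q1 p2 r2 q2 → p1 + r1 + q1 + (p2 + r2 + q2) + (r1 + r2) ≡ (p1 + r1 + (p2 + r2)) + (r1 + q1 + (r2 + q2))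
      lem = solve-∀

  needAll+needAll≤ : ∀ s1 s2 → needAll s1 + needAll s2 ≤ (needA s1 + needA s2) + (needB s1 + needB s2)
  needAll+needAll≤ s1 s2 = ≤-trans (m≤m+n _ _) (≤-reflexive (needAll+shared s1 s2))

  +suc≰ : ∀ {x k} → x + suc k ≤ x → ⊥
  +suc≰ {x} {k} h = 1+n≰n (≤-trans (s≤s (m≤m+n x k)) (≤-trans (≤-reflexive (sym (+-suc x k))) h))

  not-bothTight-A : ∀ s1 s2 p r q → needAll s1 ≡ suc (p + r + q) → needAll s2 ≡ suc (p + r + q)
       → needA s1 + needA s2 ≤ suc p + r → needB s1 + needB s2 ≤ r + q → ⊥
  not-bothTight-A s1 s2 p r q t1 t2 hA hB = +suc≰ (begin
    suc p + r + (r + q) + suc (p + q)               ≡⟨ balance p r q ⟩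
    suc (p + r + q) + suc (p + r + q)               ≡⟨ cong₂ _+_ (sym t1) (sym t2) ⟩
    needAll s1 + needAll s2                         ≤⟨ needAll+needAll≤ s1 s2 ⟩
    (needA s1 + needA s2) + (needB s1 + needB s2)   ≤⟨ +-mono-≤ hA hB ⟩
    suc p + r + (r + q)                             ∎)
    where
    open ≤-Reasoning
    balance : ∀ p r q → suc p + r + (r + q) + suc (p + q) ≡ suc (p + r + q) + suc (p + r + q)
    balance = solve-∀

  not-bothTight-B : ∀ s1 s2 p r q → needAll s1 ≡ suc (p + r + q) → needAll s2 ≡ suc (p + r + q)
       → needA s1 + needA s2 ≤ p + r → needB s1 + needB s2 ≤ r + suc q → ⊥
  not-bothTight-B s1 s2 p r q t1 t2 hA hB = +suc≰ (begin
    p + r + (r + suc q) + suc (p + q)               ≡⟨ balance p r q ⟩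
    suc (p + r + q) + suc (p + r + q)               ≡⟨ cong₂ _+_ (sym t1) (sym t2) ⟩
    needAll s1 + needAll s2                         ≤⟨ needAll+needAll≤ s1 s2 ⟩
    (needA s1 + needA s2) + (needB s1 + needB s2)   ≤⟨ +-mono-≤ hA hB ⟩
    p + r + (r + suc q)                             ∎)
    where
    open ≤-Reasoning
    balance : ∀ p r q → p + r + (r + suc q) + suc (p + q) ≡ suc (p + r + q) + suc (p + r + q)
    balance = solve-∀

  joinFits-takeA : ∀ {s1 s2 p r q} → JoinFits s1 s2 (suc p) r q
        → Settles (needA s1 + needA s2) (needA (takeA s1) + needA s2) (p + r)
        → Settles (needAll s1) (needAll (takeA s1)) (p + r + q)
        → needAll s2 ≤ p + r + q
        → JoinFits (takeA s1) s2 p r q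
  joinFits-takeA {s1} {s2} h costA dG l2 = record
    { a₁+a₂≤ = settles (+-monoˡ-≤ (needA s2) (Shrinks.A↓ m1)) a₁+a₂≤ costA
    ; b₁+b₂≤ = ≤-trans (+-monoˡ-≤ (needB s2) (Shrinks.B↓ m1)) b₁+b₂≤
    ; g₁≤ = settles (Shrinks.All↓ m1) g₁≤ dG
    ; g₂≤ = l2 }
    where open JoinFits h
          m1 = shrinks useA s1

  joinFits-takeA-tight : ∀ {p r q} s1 s2 → JoinFits s1 s2 (suc p) r q → needAll s1 ≡ suc (p + r + q) →
    needAll s2 ≤ p + r + q → JoinFits (takeA s1) s2 p r q
  joinFits-takeA-tight (demand (suc P) R Q) s2 h t1 l2 =
    joinFits-takeA h (inj₂ (+-mono-<-≤ (takeA-needA< (demand (suc P) R Q) z<s) ≤-refl))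
        (inj₂ (takeA-needAll< (demand (suc P) R Q) z<s)) l2
  joinFits-takeA-tight {p} {r} {q} (demand zero R Q) s2 h t1 l2 =
    ⊥-elim (≡suc⇒≰ t1 (≤-trans (m≤m+n (R + Q) (needB s2)) (≤-trans (JoinFits.b₁+b₂≤ h) (r+q≤p+r+q p r q))))

  joinStep-A : ∀ s1 s2 p r q → JoinFits s1 s2 (suc p) r q → JoinFits (takeA s1) s2 p r q ⊎ JoinFits s1 (takeA s2) p r q
  joinStep-A s1 s2 p r q h with ≤suc⇒≤⊎≡ (JoinFits.g₁≤ h) | ≤suc⇒≤⊎≡ (JoinFits.g₂≤ h)
  ... | inj₂ t1 | inj₂ t2 = ⊥-elim (not-bothTight-A s1 s2 p r q t1 t2 (JoinFits.a₁+a₂≤ h) (JoinFits.b₁+b₂≤ h))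
  ... | inj₂ t1 | inj₁ l2 = inj₁ (joinFits-takeA-tight s1 s2 h t1 l2)
  ... | inj₁ l1 | inj₂ t2 = inj₂ (joinFits-swap (joinFits-takeA-tight s2 s1 (joinFits-swap h) t2 l1))
  ... | inj₁ l1 | inj₁ l2 with zero⊎pos (needA s1)
  ...   | inj₂ a1pos = inj₁ (joinFits-takeA h (inj₂ (+-mono-<-≤ (takeA-needA< s1 a1pos) ≤-refl)) (inj₁ l1) l2)
  ...   | inj₁ a1z = inj₂ (joinFits-swap (joinFits-takeA (joinFits-swap h) dAA (inj₁ l2) l1))
    where
      dAA : Settles (needA s2 + needA s1) (needA (takeA s2) + needA s1) (p + r)
      dAA with ≤suc⇒≤⊎≡ (JoinFits.a₁+a₂≤ (joinFits-swap h))
      ... | inj₁ sl = inj₁ sl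
      ... | inj₂ tA = inj₂ (+-mono-<-≤
          (takeA-needA< s2 (≡suc⇒pos (trans (sym (trans (cong (needA s2 +_) a1z) (+-identityʳ (needA s2)))) tA))) ≤-refl)

  joinFits-takeB : ∀ {s1 s2 p r q} → JoinFits s1 s2 p r (suc q)
        → Settles (needB s1 + needB s2) (needB (takeB s1) + needB s2) (r + q)
        → Settles (needAll s1) (needAll (takeB s1)) (p + r + q)
        → needAll s2 ≤ p + r + q
        → JoinFits (takeB s1) s2 p r q
  joinFits-takeB {s1} {s2} {p} {r} {q} h dB' dG l2 = record
    { a₁+a₂≤ = ≤-trans (+-monoˡ-≤ (needA s2) (Shrinks.A↓ m1)) a₁+a₂≤
    ; b₁+b₂≤ = settles (+-monoˡ-≤ (needB s2) (Shrinks.B↓ m1)) (≤+suc r q b₁+b₂≤) dB'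
    ; g₁≤ = settles (Shrinks.All↓ m1) (≤+suc (p + r) q g₁≤) dG
    ; g₂≤ = l2 }
    where open JoinFits h
          m1 = shrinks useB s1

  joinFits-takeB-tight : ∀ {p r q} s1 s2 → JoinFits s1 s2 p r (suc q) → needAll s1 ≡ suc (p + r + q) →
    needAll s2 ≤ p + r + q → JoinFits (takeB s1) s2 p r q
  joinFits-takeB-tight (demand P R (suc Q)) s2 h t1 l2 =
    joinFits-takeB h (inj₂
        (+-mono-<-≤ (takeB-needB< (demand P R (suc Q)) (≤-trans (s≤s z≤n) (≤-reflexive (sym (+-suc R Q))))) ≤-refl))
                     (inj₂ (takeB-needAll< (demand P R (suc Q)) z<s)) l2
  joinFits-takeB-tight {p} {r} {q} (demand P R zero) s2 h t1 l2 =
    ⊥-elim (≡suc⇒≰ t1 (≤-trans (≤-reflexive (+-identityʳ (P + R)))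
        (≤-trans (m≤m+n (P + R) (needA s2)) (≤-trans (JoinFits.a₁+a₂≤ h) (p+r≤p+r+q p r q)))))

  joinStep-B : ∀ s1 s2 p r q → JoinFits s1 s2 p r (suc q) → JoinFits (takeB s1) s2 p r q ⊎ JoinFits s1 (takeB s2) p r q
  joinStep-B s1 s2 p r q h with ≤suc⇒≤⊎≡ (≤+suc (p + r) q (JoinFits.g₁≤ h)) | ≤suc⇒≤⊎≡ (≤+suc (p + r) q (JoinFits.g₂≤ h))
  ... | inj₂ t1 | inj₂ t2 = ⊥-elim (not-bothTight-B s1 s2 p r q t1 t2 (JoinFits.a₁+a₂≤ h) (JoinFits.b₁+b₂≤ h))
  ... | inj₂ t1 | inj₁ l2 = inj₁ (joinFits-takeB-tight s1 s2 h t1 l2)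
  ... | inj₁ l1 | inj₂ t2 = inj₂ (joinFits-swap (joinFits-takeB-tight s2 s1 (joinFits-swap h) t2 l1))
  ... | inj₁ l1 | inj₁ l2 with zero⊎pos (needB s1)
  ...   | inj₂ b1pos = inj₁ (joinFits-takeB h (inj₂ (+-mono-<-≤ (takeB-needB< s1 b1pos) ≤-refl)) (inj₁ l1) l2)
  ...   | inj₁ b1z = inj₂ (joinFits-swap (joinFits-takeB (joinFits-swap h) dBB (inj₁ l2) l1))
    where
      dBB : Settles (needB s2 + needB s1) (needB (takeB s2) + needB s1) (r + q)
      dBB with ≤suc⇒≤⊎≡ (≤+suc r q (JoinFits.b₁+b₂≤ (joinFits-swap h)))
      ... | inj₁ sl = inj₁ sl
      ... | inj₂ tB = inj₂ (+-mono-<-≤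
          (takeB-needB< s2 (≡suc⇒pos (trans (sym (trans (cong (needB s2 +_) b1z) (+-identityʳ (needB s2)))) tB))) ≤-refl)

  -- How one shared colour is handed out in a join: as an A-colour to one part
  -- and a B-colour to the other (no edges join them), or to just one part.
  data JoinMove : Set where
    splitAB splitBA : JoinMove
    first second : SharedUse → JoinMove

  joinUse₁ : JoinMove → Use
  joinUse₁ splitAB = useA
  joinUse₁ splitBA = useB
  joinUse₁ (first o) = sharedUse o
  joinUse₁ (second o) = skip

  joinUse₂ : JoinMove → Use
  joinUse₂ splitAB = useB
  joinUse₂ splitBA = useA
  joinUse₂ (first o) = skip
  joinUse₂ (second o) = sharedUse o

  JoinStep : Demand → Demand → ℕ → ℕ → ℕ → Set
  JoinStep s1 s2 p r q = Σ JoinMove λ ρ → JoinFits (after (joinUse₁ ρ) s1) (after (joinUse₂ ρ) s2) p r q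

  joinStep-swap : ∀ {s1 s2 p r q} → JoinStep s2 s1 p r q → JoinStep s1 s2 p r q
  joinStep-swap (splitAB , h) = splitBA , joinFits-swap h
  joinStep-swap (splitBA , h) = splitAB , joinFits-swap h
  joinStep-swap (first o , h) = second o , joinFits-swap h
  joinStep-swap (second o , h) = first o , joinFits-swap h

  record SharedJoinFits (s1 s2 : Demand) (p r q : ℕ) : Set where
    field
      a₁+a₂≤ : needA s1 + needA s2 ≤ suc (p + r)
      b₁+b₂≤ : needB s1 + needB s2 ≤ suc (r + q)
      g₁≤ : needAll s1 ≤ suc (p + r + q)
      g₂≤ : needAll s2 ≤ suc (p + r + q)

  sharedJoinFits-swap : ∀ {s1 s2 p r q} → SharedJoinFits s1 s2 p r q → SharedJoinFits s2 s1 p r q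
  sharedJoinFits-swap {s1} {s2} {p} {r} {q} h = record
    { a₁+a₂≤ = subst (_≤ suc (p + r)) (+-comm (needA s1) (needA s2)) a₁+a₂≤
    ; b₁+b₂≤ = subst (_≤ suc (r + q)) (+-comm (needB s1) (needB s2)) b₁+b₂≤
    ; g₁≤ = g₂≤ ; g₂≤ = g₁≤ }
    where open SharedJoinFits h

  joinFits-after : ∀ {s1 s2 p r q} o1 o2 → SharedJoinFits s1 s2 p r q
        → Settles (needA s1 + needA s2) (needA (after o1 s1) + needA (after o2 s2)) (p + r)
        → Settles (needB s1 + needB s2) (needB (after o1 s1) + needB (after o2 s2)) (r + q)
        → Settles (needAll s1) (needAll (after o1 s1)) (p + r + q)
        → Settles (needAll s2) (needAll (after o2 s2)) (p + r + q)
        → JoinFits (after o1 s1) (after o2 s2) p r q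
  joinFits-after {s1} {s2} o1 o2 h da db d1 d2 = record
    { a₁+a₂≤ = settles (+-mono-≤ (Shrinks.A↓ m1) (Shrinks.A↓ m2)) a₁+a₂≤ da
    ; b₁+b₂≤ = settles (+-mono-≤ (Shrinks.B↓ m1) (Shrinks.B↓ m2)) b₁+b₂≤ db
    ; g₁≤ = settles (Shrinks.All↓ m1) g₁≤ d1
    ; g₂≤ = settles (Shrinks.All↓ m2) g₂≤ d2 }
    where open SharedJoinFits h
          m1 = shrinks o1 s1
          m2 = shrinks o2 s2

  twoSides≰ : ∀ p r q → suc (p + r) + suc (r + q) ≤ suc (p + r + q) → ⊥
  twoSides≰ p r q h = +suc≰ {suc (p + r + q)} {r} (≤-trans (≤-reflexive (lem p r q)) h)
    where lem : ∀ p r q → suc (p + r + q) + suc r ≡ suc (p + r) + suc (r + q)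
          lem = solve-∀

  needAll≡needA+onlyB : ∀ s → needAll s ≡ needA s + onlyB s
  needAll≡needA+onlyB (demand p r q) = refl

  onlyB≤needB : ∀ s → onlyB s ≤ needB s
  onlyB≤needB (demand p r q) = m≤n+m q r

  joinStep-bothTight : ∀ s1 s2 p r q → SharedJoinFits s1 s2 p r q → needAll s1 ≡ suc (p + r + q) → needAll s2 ≡ suc
      (p + r + q) → JoinStep s1 s2 p r q
  joinStep-bothTight s1 s2 p r q h t1 t2 with zero⊎pos (needA s1)
  ... | inj₂ a1pos =
    splitAB , joinFits-after useA useB h (inj₂ (+-mono-<-≤ (takeA-needA< s1 a1pos) (Shrinks.A↓ (shrinks useB s2))))
                          (inj₂ (+-mono-≤-< (Shrinks.B↓ (shrinks useA s1)) (takeB-needB< s2 b2pos)))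
                          (inj₂ (takeA-needAll< s1 P1pos)) (inj₂ (takeB-needAll< s2 Q2pos))
    where
      open SharedJoinFits h
      a1≤Q2 : needA s1 ≤ onlyB s2
      a1≤Q2 = +-cancelˡ-≤ (needA s2) (needA s1) (onlyB s2)
                (≤-trans (≤-reflexive (+-comm (needA s2) (needA s1)))
                    (≤-trans a₁+a₂≤ (≤-trans (s≤s (p+r≤p+r+q p r q))
                    (≤-reflexive (trans (sym t2) (needAll≡needA+onlyB s2))))))
      b2≤P1 : needB s2 ≤ onlyA s1
      b2≤P1 = +-cancelˡ-≤ (needB s1) (needB s2) (onlyA s1)
                (≤-trans b₁+b₂≤ (≤-trans (s≤s (r+q≤p+r+q p r q))
                    (≤-reflexive (trans (sym t1) (trans (needAll≡onlyA+needB s1) (+-comm (onlyA s1) (needB s1)))))))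
      Q2pos = <-≤-trans a1pos a1≤Q2
      b2pos = <-≤-trans Q2pos (onlyB≤needB s2)
      P1pos = <-≤-trans b2pos b2≤P1
  ... | inj₁ a1z =
    splitBA , joinFits-after useB useA h (inj₂ (+-mono-≤-< (Shrinks.A↓ (shrinks useB s1)) (takeA-needA< s2 a2pos)))
                          (inj₂ (+-mono-<-≤ (takeB-needB< s1 b1pos) (Shrinks.B↓ (shrinks useA s2))))
                          (inj₂ (takeB-needAll< s1 Q1pos)) (inj₂ (takeA-needAll< s2 P2pos))
    where
      open SharedJoinFits h
      Q1pos : 0 < onlyB s1
      Q1pos = ≡suc⇒pos (trans (sym (trans (needAll≡needA+onlyB s1) (cong (_+ onlyB s1) a1z))) t1)
      b1pos = <-≤-trans Q1pos (onlyB≤needB s1)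
      b1≤P2 : needB s1 ≤ onlyA s2
      b1≤P2 = +-cancelʳ-≤ (needB s2) (needB s1) (onlyA s2)
                (≤-trans b₁+b₂≤ (≤-trans (s≤s (r+q≤p+r+q p r q)) (≤-reflexive (trans (sym t2) (needAll≡onlyA+needB s2)))))
      P2pos = <-≤-trans b1pos b1≤P2
      a2pos = <-≤-trans P2pos (onlyA≤needA s2)

  noShared⇒needAll : ∀ s → shared s ≡ 0 → needAll s ≡ needA s + needB s
  noShared⇒needAll (demand p .0 q) refl = refl

  joinStep-oneTight-crowded : ∀ P1 Q1 s2 p r q → SharedJoinFits (demand P1 zero Q1) s2 p r q →
    needAll (demand P1 zero Q1) ≡ suc (p + r + q) → needAll s2 ≤ p + r + q →
    needA (demand P1 zero Q1) + needA s2 ≡ suc (p + r) → needB (demand P1 zero Q1) + needB s2 ≡ suc (r + q) →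
    JoinStep (demand P1 zero Q1) s2 p r q
  joinStep-oneTight-crowded (suc P1) Q1 s2 p r q h t1 l2 tA tB with zero⊎pos (needB s2)
  ... | inj₂ b2pos =
    splitAB , joinFits-after useA useB h (inj₂ (+-mono-<-≤ (takeA-needA< s1 z<s) (Shrinks.A↓ (shrinks useB s2))))
                          (inj₂ (+-mono-≤-< (Shrinks.B↓ (shrinks useA s1)) (takeB-needB< s2 b2pos)))
                          (inj₂ (takeA-needAll< s1 z<s)) (inj₁ l2)
    where s1 = demand (suc P1) zero Q1
  ... | inj₁ b2z with Q1 | zero⊎pos (needA s2)
  ...   | suc Q1' | inj₂ a2pos =
    splitBA , joinFits-after useB useA h (inj₂ (+-mono-≤-< (Shrinks.A↓ (shrinks useB s1)) (takeA-needA< s2 a2pos)))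
                          (inj₂ (+-mono-<-≤ (takeB-needB< s1 z<s) (Shrinks.B↓ (shrinks useA s2))))
                          (inj₂ (takeB-needAll< s1 z<s)) (inj₁ l2)
    where s1 = demand (suc P1) zero (suc Q1')
  ...   | suc Q1' | inj₁ a2z = ⊥-elim
      (twoSides≰ p r q (≤-trans (≤-reflexive (cong₂ _+_ (sym eA) (sym eB))) (≤-reflexive t1)))
    where
      eA : suc P1 + 0 ≡ suc (p + r)
      eA = trans (sym (trans (cong (suc P1 + 0 +_) a2z) (+-identityʳ _))) tA
      eB : suc Q1' ≡ suc (r + q)
      eB = trans (sym (trans (cong (suc Q1' +_) b2z) (+-identityʳ _))) tB
  ...   | zero | _ = ⊥-elim (0≢1+n (trans (sym b2z) tB))
  joinStep-oneTight-crowded zero (suc Q1) s2 p r q h t1 l2 tA tB with zero⊎pos (needA s2)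
  ... | inj₂ a2pos =
    splitBA , joinFits-after useB useA h (inj₂ (+-mono-≤-< (Shrinks.A↓ (shrinks useB s1)) (takeA-needA< s2 a2pos)))
                          (inj₂ (+-mono-<-≤ (takeB-needB< s1 z<s) (Shrinks.B↓ (shrinks useA s2))))
                          (inj₂ (takeB-needAll< s1 z<s)) (inj₁ l2)
    where s1 = demand zero zero (suc Q1)
  ... | inj₁ a2z = ⊥-elim (0≢1+n (trans (sym a2z) tA))
  joinStep-oneTight-crowded zero zero s2 p r q h t1 l2 tA tB = ⊥-elim (0≢1+n t1)

  joinStep-oneTight : ∀ s1 s2 p r q → SharedJoinFits s1 s2 p r q → needAll s1 ≡ suc
      (p + r + q) → needAll s2 ≤ p + r + q → JoinStep s1 s2 p r q
  joinStep-oneTight (demand P1 (suc R1) Q1) s2 p r q h t1 l2 =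
    first forBoth , joinFits-after useShared skip h (inj₂ (+-mono-<-≤ (takeShared-needA< s1 z<s) ≤-refl))
        (inj₂ (+-mono-<-≤ (takeShared-needB< s1 z<s) ≤-refl))
                            (inj₂ (takeShared-needAll< s1 z<s)) (inj₁ l2)
    where s1 = demand P1 (suc R1) Q1
  joinStep-oneTight (demand P1 zero Q1) s2 p r q h t1 l2 with ≤suc⇒≤⊎≡ (SharedJoinFits.a₁+a₂≤ h) | ≤suc⇒≤⊎≡
      (SharedJoinFits.b₁+b₂≤ h)
  joinStep-oneTight (demand P1 zero Q1) s2 p r q h t1 l2 | inj₂ tA | inj₂ tB = joinStep-oneTight-crowded P1 Q1 s2 p r q h t1 l2 tA tB
  joinStep-oneTight (demand (suc P1) zero Q1) s2 p r q h t1 l2 | inj₂ tA | inj₁ sB =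
    first forA , joinFits-after useSharedA skip h (inj₂ (+-mono-<-≤ (takeSharedA-needA< s1 z<s) ≤-refl)) (inj₁ sB)
        (inj₂ (takeSharedA-needAll< s1 z<s)) (inj₁ l2)
    where s1 = demand (suc P1) zero Q1
  joinStep-oneTight (demand zero zero Q1) s2 p r q h t1 l2 | inj₂ tA | inj₁ sB =
    ⊥-elim (≡suc⇒≰ t1 (≤-trans (m≤m+n Q1 (needB s2)) (≤-trans sB (r+q≤p+r+q p r q))))
  joinStep-oneTight (demand P1 zero (suc Q1)) s2 p r q h t1 l2 | inj₁ sA | inj₂ tB =
    first forB , joinFits-after useSharedB skip h (inj₁ sA) (inj₂ (+-mono-<-≤ (takeSharedB-needB< s1 z<s) ≤-refl))
        (inj₂ (takeSharedB-needAll< s1 z<s)) (inj₁ l2)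
    where s1 = demand P1 zero (suc Q1)
  joinStep-oneTight (demand P1 zero zero) s2 p r q h t1 l2 | inj₁ sA | inj₂ tB =
    ⊥-elim (≡suc⇒≰ t1 (≤-trans (m≤m+n (P1 + 0 + 0) (needA s2))
        (≤-trans (≤-trans (≤-reflexive (cong (_+ needA s2) (+-identityʳ (P1 + 0)))) sA) (p+r≤p+r+q p r q))))
  joinStep-oneTight (demand (suc P1) zero Q1) s2 p r q h t1 l2 | inj₁ sA | inj₁ sB =
    first forA , joinFits-after useSharedA skip h (inj₁ sA) (inj₁ sB) (inj₂ (takeSharedA-needAll< s1 z<s)) (inj₁ l2)
    where s1 = demand (suc P1) zero Q1
  joinStep-oneTight (demand zero zero Q1) s2 p r q h t1 l2 | inj₁ sA | inj₁ sB =
    first forB , joinFits-after useSharedB skip h (inj₁ sA) (inj₁ sB) (inj₂ (takeSharedB-needAll< s1 (≡suc⇒pos t1)))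
        (inj₁ l2)
    where s1 = demand zero zero Q1

  bothPos⊎zero : ∀ x y → (0 < x × 0 < y) ⊎ (x ≡ 0 ⊎ y ≡ 0)
  bothPos⊎zero zero y = inj₂ (inj₁ refl)
  bothPos⊎zero (suc x) zero = inj₂ (inj₂ refl)
  bothPos⊎zero (suc x) (suc y) = inj₁ (z<s , z<s)

  joinStep-bothSidesTight : ∀ s1 s2 p r q → SharedJoinFits s1 s2 p r q → needAll s1 ≤ p + r + q → needAll s2 ≤ p + r + q
       → needA s1 + needA s2 ≡ suc (p + r) → needB s1 + needB s2 ≡ suc (r + q) → JoinStep s1 s2 p r q
  joinStep-bothSidesTight s1 s2 p r q h l1 l2 tA tB with bothPos⊎zero (needA s1) (needB s2)
  ... | inj₁ (a1pos , b2pos) =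
    splitAB , joinFits-after useA useB h (inj₂ (+-mono-<-≤ (takeA-needA< s1 a1pos) (Shrinks.A↓ (shrinks useB s2))))
                          (inj₂ (+-mono-≤-< (Shrinks.B↓ (shrinks useA s1)) (takeB-needB< s2 b2pos))) (inj₁ l1) (inj₁ l2)
  ... | inj₂ x with bothPos⊎zero (needB s1) (needA s2)
  ...   | inj₁ (b1pos , a2pos) =
    splitBA , joinFits-after useB useA h (inj₂ (+-mono-≤-< (Shrinks.A↓ (shrinks useB s1)) (takeA-needA< s2 a2pos)))
                          (inj₂ (+-mono-<-≤ (takeB-needB< s1 b1pos) (Shrinks.B↓ (shrinks useA s2)))) (inj₁ l1) (inj₁ l2)
  ...   | inj₂ y with zero⊎pos (shared s1) | zero⊎pos (shared s2)
  ...     | inj₂ R1pos | _ =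
    first forBoth , joinFits-after useShared skip h (inj₂ (+-mono-<-≤ (takeShared-needA< s1 R1pos) ≤-refl))
        (inj₂ (+-mono-<-≤ (takeShared-needB< s1 R1pos) ≤-refl)) (inj₁ l1) (inj₁ l2)
  ...     | inj₁ R1z | inj₂ R2pos =
    second forBoth , joinFits-after skip useShared h (inj₂ (+-mono-≤-< {needA s1} ≤-refl (takeShared-needA< s2 R2pos)))
        (inj₂ (+-mono-≤-< {needB s1} ≤-refl (takeShared-needB< s2 R2pos))) (inj₁ l1) (inj₁ l2)
  ...     | inj₁ R1z | inj₁ R2z = ⊥-elim (contra x y)
    where
      contra : (needA s1 ≡ 0 ⊎ needB s2 ≡ 0) → (needB s1 ≡ 0 ⊎ needA s2 ≡ 0) → ⊥
      contra (inj₁ a1z) (inj₁ b1z) = twoSides≰ p r q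
          (≤-trans (≤-reflexive (cong₂ _+_ (sym eA) (sym eB)))
          (≤-trans (≤-reflexive (sym (noShared⇒needAll s2 R2z))) (≤-trans l2 (n≤1+n _))))
        where eA : needA s2 ≡ suc (p + r)
              eA = trans (cong (_+ needA s2) (sym a1z)) tA
              eB : needB s2 ≡ suc (r + q)
              eB = trans (cong (_+ needB s2) (sym b1z)) tB
      contra (inj₁ a1z) (inj₂ a2z) = 0≢1+n (trans (cong₂ _+_ (sym a1z) (sym a2z)) tA)
      contra (inj₂ b2z) (inj₁ b1z) = 0≢1+n (trans (cong₂ _+_ (sym b1z) (sym b2z)) tB)
      contra (inj₂ b2z) (inj₂ a2z) = twoSides≰ p r q
          (≤-trans (≤-reflexive (cong₂ _+_ (sym eA) (sym eB)))
          (≤-trans (≤-reflexive (sym (noShared⇒needAll s1 R1z))) (≤-trans l1 (n≤1+n _))))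
        where eA : needA s1 ≡ suc (p + r)
              eA = trans (sym (trans (cong (needA s1 +_) a2z) (+-identityʳ _))) tA
              eB : needB s1 ≡ suc (r + q)
              eB = trans (sym (trans (cong (needB s1 +_) b2z) (+-identityʳ _))) tB

  joinStep-noneTight : ∀ s1 s2 p r q → SharedJoinFits s1 s2 p r q → needAll s1 ≤ p + r + q → needAll s2 ≤ p + r + q → JoinStep s1 s2 p r q
  joinStep-noneTight s1 s2 p r q h l1 l2 with ≤suc⇒≤⊎≡ (SharedJoinFits.a₁+a₂≤ h) | ≤suc⇒≤⊎≡ (SharedJoinFits.b₁+b₂≤ h)
  ... | inj₂ tA | inj₂ tB = joinStep-bothSidesTight s1 s2 p r q h l1 l2 tA tB
  ... | inj₂ tA | inj₁ sB with zero⊎pos (needA s1)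
  ...   | inj₂ a1pos = splitAB , joinFits-after useA useB h
      (inj₂ (+-mono-<-≤ (takeA-needA< s1 a1pos) (Shrinks.A↓ (shrinks useB s2)))) (inj₁ sB) (inj₁ l1) (inj₁ l2)
  ...   | inj₁ a1z = splitBA , joinFits-after useB useA h
      (inj₂ (+-mono-≤-< (Shrinks.A↓ (shrinks useB s1))
      (takeA-needA< s2 (≡suc⇒pos (trans (cong (_+ needA s2) (sym a1z)) tA))))) (inj₁ sB) (inj₁ l1) (inj₁ l2)
  joinStep-noneTight s1 s2 p r q h l1 l2 | inj₁ sA | inj₂ tB with zero⊎pos (needB s2)
  ...   | inj₂ b2pos = splitAB , joinFits-after useA useB h (inj₁ sA)
      (inj₂ (+-mono-≤-< (Shrinks.B↓ (shrinks useA s1)) (takeB-needB< s2 b2pos))) (inj₁ l1) (inj₁ l2)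
  ...   | inj₁ b2z = splitBA , joinFits-after useB useA h (inj₁ sA)
      (inj₂ (+-mono-<-≤ (takeB-needB< s1 (≡suc⇒pos (trans (sym (trans (cong (needB s1 +_) b2z) (+-identityʳ _))) tB)))
      (Shrinks.B↓ (shrinks useA s2)))) (inj₁ l1) (inj₁ l2)
  joinStep-noneTight s1 s2 p r q h l1 l2 | inj₁ sA | inj₁ sB = splitAB , joinFits-after useA useB h (inj₁ sA) (inj₁ sB)
      (inj₁ l1) (inj₁ l2)

  joinFits⇒shared : ∀ {s1 s2 p r q} → JoinFits s1 s2 p (suc r) q → SharedJoinFits s1 s2 p r q
  joinFits⇒shared {s1} {s2} {p} {r} {q} h = record
    { a₁+a₂≤ = ≤+suc p r a₁+a₂≤ ; b₁+b₂≤ = b₁+b₂≤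
    ; g₁≤ = ≤-trans g₁≤ (≤-reflexive (cong (_+ q) (+-suc p r)))
    ; g₂≤ = ≤-trans g₂≤ (≤-reflexive (cong (_+ q) (+-suc p r))) }
    where open JoinFits h

  joinStep-shared : ∀ s1 s2 p r q → JoinFits s1 s2 p (suc r) q → JoinStep s1 s2 p r q
  joinStep-shared s1 s2 p r q h0 with ≤suc⇒≤⊎≡ (SharedJoinFits.g₁≤ h) | ≤suc⇒≤⊎≡ (SharedJoinFits.g₂≤ h)
    where h = joinFits⇒shared h0
  ... | inj₂ t1 | inj₂ t2 = joinStep-bothTight s1 s2 p r q (joinFits⇒shared h0) t1 t2
  ... | inj₂ t1 | inj₁ l2 = joinStep-oneTight s1 s2 p r q (joinFits⇒shared h0) t1 l2
  ... | inj₁ l1 | inj₂ t2 = joinStep-swap (joinStep-oneTight s2 s1 p r q (sharedJoinFits-swap (joinFits⇒shared h0)) t2 l1)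
  ... | inj₁ l1 | inj₁ l2 = joinStep-noneTight s1 s2 p r q (joinFits⇒shared h0) l1 l2

  -- The bounds relating the sizes a, b, g of largest label-true, label-false
  -- and arbitrary cliques; they are exactly the needs of demands.
  SizeBounds : ℕ → ℕ → ℕ → Set
  SizeBounds a b g = a ≤ g × b ≤ g × g ≤ a + b

  demandOf : ∀ {a b g} → SizeBounds a b g → Σ Demand λ s → needA s ≡ a × needB s ≡ b × needAll s ≡ g
  demandOf {a} {b} {g} (needA≤needAll , needB≤needAll , needAll≤needA+needB) with m≤n⇒∃[o]m+o≡n needB≤needAll | m≤n⇒∃[o]m+o≡n needAll≤needA+needB | m≤n⇒∃[o]m+o≡n needA≤needAll
  ... | x , b+x≡g | y , g+y≡a+b | z , a+z≡g = demand x y z , x+y≡a , y+z≡b , trans (cong (_+ z) x+y≡a) a+z≡g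
    where
    x+y≡a : x + y ≡ a
    x+y≡a = +-cancelˡ-≡ b (x + y) a (begin
      b + (x + y)   ≡⟨ sym (+-assoc b x y) ⟩
      b + x + y     ≡⟨ cong (_+ y) b+x≡g ⟩
      g + y         ≡⟨ g+y≡a+b ⟩
      a + b         ≡⟨ +-comm a b ⟩
      b + a         ∎)
      where open ≡-Reasoning
    y+z≡b : y + z ≡ b
    y+z≡b = +-cancelˡ-≡ a (y + z) b (begin
      a + (y + z)   ≡⟨ cong (a +_) (+-comm y z) ⟩
      a + (z + y)   ≡⟨ sym (+-assoc a z y) ⟩
      a + z + y     ≡⟨ cong (_+ y) a+z≡g ⟩
      g + y         ≡⟨ g+y≡a+b ⟩
      a + b         ∎)
      where open ≡-Reasoning

-- Palettes of tagged colours, and their splitting between the parts of a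
-- union or a join, driven by the steps of Demands.
module Palettes where

  open import Data.Nat
  open import Data.Nat.Properties
  open import Data.Product using (Σ; _×_; _,_; proj₁; proj₂)
  open import Data.Sum using (_⊎_; inj₁; inj₂)
  open import Data.Empty using (⊥; ⊥-elim)
  open import Data.Unit using (⊤; tt)
  open import Data.Bool using (Bool; true; false)
  open import Data.List using (List; []; _∷_; length)
  open import Data.List.Relation.Unary.Any using (here; there)
  open import Data.List.Membership.Propositional using (_∈_)
  open import Relation.Binary.PropositionalEquality
  open import Data.Nat.Tactic.RingSolver
  open Demands

  -- A palette is a list of colours (natural numbers), each tagged P (usable on
  -- label-true vertices only), Q (label-false only) or R (both labels).
  data Tag : Set where
    tP tR tQ : Tag

  Palette : Set
  Palette = List (Tag × ℕ)

  UsableA : Tag → Set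
  UsableA tP = ⊤
  UsableA tR = ⊤
  UsableA tQ = ⊥

  UsableB : Tag → Set
  UsableB tP = ⊥
  UsableB tR = ⊤
  UsableB tQ = ⊤

  Usable : Bool → Tag → Set
  Usable true = UsableA
  Usable false = UsableB

  roomA : Palette → ℕ
  roomA [] = 0
  roomA ((tP , _) ∷ xs) = suc (roomA xs)
  roomA ((tR , _) ∷ xs) = suc (roomA xs)
  roomA ((tQ , _) ∷ xs) = roomA xs

  roomB : Palette → ℕ
  roomB [] = 0
  roomB ((tP , _) ∷ xs) = roomB xs
  roomB ((tR , _) ∷ xs) = suc (roomB xs)
  roomB ((tQ , _) ∷ xs) = suc (roomB xs)

  countP countR countQ : Palette → ℕ
  countP [] = 0
  countP ((tP , _) ∷ xs) = suc (countP xs)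
  countP ((tR , _) ∷ xs) = countP xs
  countP ((tQ , _) ∷ xs) = countP xs
  countR [] = 0
  countR ((tP , _) ∷ xs) = countR xs
  countR ((tR , _) ∷ xs) = suc (countR xs)
  countR ((tQ , _) ∷ xs) = countR xs
  countQ [] = 0
  countQ ((tP , _) ∷ xs) = countQ xs
  countQ ((tR , _) ∷ xs) = countQ xs
  countQ ((tQ , _) ∷ xs) = suc (countQ xs)

  roomA≡ : ∀ p → roomA p ≡ countP p + countR p
  roomA≡ [] = refl
  roomA≡ ((tP , _) ∷ xs) = cong suc (roomA≡ xs)
  roomA≡ ((tR , _) ∷ xs) = trans (cong suc (roomA≡ xs)) (sym (+-suc (countP xs) (countR xs)))
  roomA≡ ((tQ , _) ∷ xs) = roomA≡ xs

  roomB≡ : ∀ p → roomB p ≡ countR p + countQ p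
  roomB≡ [] = refl
  roomB≡ ((tP , _) ∷ xs) = roomB≡ xs
  roomB≡ ((tR , _) ∷ xs) = cong suc (roomB≡ xs)
  roomB≡ ((tQ , _) ∷ xs) = trans (cong suc (roomB≡ xs)) (sym (+-suc (countR xs) (countQ xs)))

  length≡ : ∀ p → length p ≡ countP p + countR p + countQ p
  length≡ [] = refl
  length≡ ((tP , _) ∷ xs) = cong suc (length≡ xs)
  length≡ ((tR , _) ∷ xs) = trans (cong suc (length≡ xs)) (cong (_+ countQ xs) (sym (+-suc (countP xs) (countR xs))))
  length≡ ((tQ , _) ∷ xs) = trans (cong suc (length≡ xs)) (sym (+-suc (countP xs + countR xs) (countQ xs)))

  Unused : ℕ → Palette → Set
  Unused c xs = ∀ {t} → (t , c) ∈ xs → ⊥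

  data Distinct : Palette → Set where
    dnil : Distinct []
    dcons : ∀ {t c xs} → Unused c xs → Distinct xs → Distinct ((t , c) ∷ xs)

  -- A part may use a colour with a more restrictive tag than the palette gives it.
  data _⊑_ : Tag → Tag → Set where
    PP : tP ⊑ tP
    PR : tP ⊑ tR
    QQ : tQ ⊑ tQ
    QR : tQ ⊑ tR
    RR : tR ⊑ tR

  usable⊑ : ∀ {l t t'} → t ⊑ t' → Usable l t → Usable l t'
  usable⊑ PP u = u
  usable⊑ QQ u = u
  usable⊑ RR u = u
  usable⊑ {true}  PR _ = tt
  usable⊑ {false} QR _ = tt

  Refines : Palette → Palette → Set
  Refines p1 p = ∀ {t c} → (t , c) ∈ p1 → Σ Tag λ t' → (t' , c) ∈ p × t ⊑ t'

  -- Tags under which the two parts of a union (resp. join) may share a colour: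
  -- no edge of the switched graph can join the two uses.
  data UnionCompatible : Tag → Tag → Set where
    bothP : UnionCompatible tP tP
    bothQ : UnionCompatible tQ tQ

  data JoinCompatible : Tag → Tag → Set where
    PQ : JoinCompatible tP tQ
    QP : JoinCompatible tQ tP

  Cross : (Tag → Tag → Set) → Palette → Palette → Set
  Cross C p1 p2 = ∀ {t1 t2 c} → (t1 , c) ∈ p1 → (t2 , c) ∈ p2 → C t1 t2

  Fits : ℕ → ℕ → ℕ → Palette → Set
  Fits a b g p = a ≤ roomA p × b ≤ roomB p × g ≤ length p

  Meets : Demand → Palette → Set
  Meets s p = Fits (needA s) (needB s) (needAll s) p

  tagOf : Use → Tag
  tagOf skip = tR
  tagOf useA = tP
  tagOf useB = tQ
  tagOf useShared = tR
  tagOf useSharedA = tR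
  tagOf useSharedB = tR

  assign : Use → ℕ → Palette → Palette
  assign skip c p = p
  assign o c p = (tagOf o , c) ∷ p

  assign-roomA : ∀ o c p → roomA (assign o c p) ≡ costA o + roomA p
  assign-roomA skip c p = refl
  assign-roomA useA c p = refl
  assign-roomA useB c p = refl
  assign-roomA useShared c p = refl
  assign-roomA useSharedA c p = refl
  assign-roomA useSharedB c p = refl

  assign-roomB : ∀ o c p → roomB (assign o c p) ≡ costB o + roomB p
  assign-roomB skip c p = refl
  assign-roomB useA c p = refl
  assign-roomB useB c p = refl
  assign-roomB useShared c p = refl
  assign-roomB useSharedA c p = refl
  assign-roomB useSharedB c p = refl

  assign-length : ∀ o c p → length (assign o c p) ≡ costAll o + length p
  assign-length skip c p = refl
  assign-length useA c p = refl
  assign-length useB c p = refl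
  assign-length useShared c p = refl
  assign-length useSharedA c p = refl
  assign-length useSharedB c p = refl

  ∈-assign : ∀ o {c p t c'} → (t , c') ∈ assign o c p → ((o ≡ skip → ⊥) × t ≡ tagOf o × c' ≡ c) ⊎ (t , c') ∈ p
  ∈-assign skip m = inj₂ m
  ∈-assign useA (here refl) = inj₁ ((λ ()) , refl , refl)
  ∈-assign useA (there m) = inj₂ m
  ∈-assign useB (here refl) = inj₁ ((λ ()) , refl , refl)
  ∈-assign useB (there m) = inj₂ m
  ∈-assign useShared (here refl) = inj₁ ((λ ()) , refl , refl)
  ∈-assign useShared (there m) = inj₂ m
  ∈-assign useSharedA (here refl) = inj₁ ((λ ()) , refl , refl)
  ∈-assign useSharedA (there m) = inj₂ m
  ∈-assign useSharedB (here refl) = inj₁ ((λ ()) , refl , refl)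
  ∈-assign useSharedB (there m) = inj₂ m

  Allowed : Tag → Use → Set
  Allowed t skip = ⊤
  Allowed tP useA = ⊤
  Allowed tR useA = ⊤
  Allowed tQ useB = ⊤
  Allowed tR useB = ⊤
  Allowed tR useShared = ⊤
  Allowed tR useSharedA = ⊤
  Allowed tR useSharedB = ⊤
  Allowed _ _ = ⊥

  allowed⊑ : ∀ t o → Allowed t o → (o ≡ skip → ⊥) → tagOf o ⊑ t
  allowed⊑ t skip _ ne = ⊥-elim (ne refl)
  allowed⊑ tP useA _ _ = PP
  allowed⊑ tR useA _ _ = PR
  allowed⊑ tQ useB _ _ = QQ
  allowed⊑ tR useB _ _ = QR
  allowed⊑ tR useShared _ _ = RR
  allowed⊑ tR useSharedA _ _ = RR
  allowed⊑ tR useSharedB _ _ = RR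

  data CompatibleUses (C : Tag → Tag → Set) : Use → Use → Set where
    skip₁ : ∀ {o} → CompatibleUses C skip o
    skip₂ : ∀ {o} → CompatibleUses C o skip
    tagged : ∀ {o1 o2} → C (tagOf o1) (tagOf o2) → CompatibleUses C o1 o2

  record Parts (C : Tag → Tag → Set) (pal p1 p2 : Palette) : Set where
    field
      distinct₁ : Distinct p1
      distinct₂ : Distinct p2
      refines₁ : Refines p1 pal
      refines₂ : Refines p2 pal
      agree : Cross C p1 p2

  assign-distinct : ∀ o {c p pal} → Unused c pal → Refines p pal → Distinct p → Distinct (assign o c p)
  assign-distinct skip nin rf d = d
  assign-distinct useA nin rf d = dcons (λ m → nin (proj₁ (proj₂ (rf m)))) d
  assign-distinct useB nin rf d = dcons (λ m → nin (proj₁ (proj₂ (rf m)))) d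
  assign-distinct useShared nin rf d = dcons (λ m → nin (proj₁ (proj₂ (rf m)))) d
  assign-distinct useSharedA nin rf d = dcons (λ m → nin (proj₁ (proj₂ (rf m)))) d
  assign-distinct useSharedB nin rf d = dcons (λ m → nin (proj₁ (proj₂ (rf m)))) d

  assign-refines : ∀ o {t c p pal} → Allowed t o → Refines p pal → Refines (assign o c p) ((t , c) ∷ pal)
  assign-refines o {t} al rf m with ∈-assign o m
  ... | inj₁ (ne , refl , refl) = t , here refl , allowed⊑ t o al ne
  ... | inj₂ m' = let (t' , m'' , le) = rf m' in t' , there m'' , le

  assign-cross : ∀ {C} o1 o2 {c p1 p2 pal} → CompatibleUses C o1 o2 → Unused c pal → Refines p1 pal → Refines p2 pal
           → Cross C p1 p2 → Cross C (assign o1 c p1) (assign o2 c p2)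
  assign-cross o1 o2 cm nin rf1 rf2 agree m1 m2 with ∈-assign o1 m1 | ∈-assign o2 m2
  ... | inj₁ (ne1 , refl , refl) | inj₁ (ne2 , refl , refl) = go cm
    where
      go : CompatibleUses _ o1 o2 → _
      go skip₁ = ⊥-elim (ne1 refl)
      go skip₂ = ⊥-elim (ne2 refl)
      go (tagged x) = x
  ... | inj₁ (ne1 , refl , refl) | inj₂ m2' = ⊥-elim (nin (proj₁ (proj₂ (rf2 m2'))))
  ... | inj₂ m1' | inj₁ (ne2 , refl , refl) = ⊥-elim (nin (proj₁ (proj₂ (rf1 m1'))))
  ... | inj₂ m1' | inj₂ m2' = agree m1' m2'

  parts-assign : ∀ {C} o1 o2 {t c pal p1 p2} → Allowed t o1 → Allowed t o2 → CompatibleUses C o1 o2 → Unused c pal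
         → Parts C pal p1 p2 → Parts C ((t , c) ∷ pal) (assign o1 c p1) (assign o2 c p2)
  parts-assign o1 o2 a1 a2 cm nin g = record
    { distinct₁ = assign-distinct o1 nin refines₁ distinct₁
    ; distinct₂ = assign-distinct o2 nin refines₂ distinct₂
    ; refines₁ = assign-refines o1 a1 refines₁
    ; refines₂ = assign-refines o2 a2 refines₂
    ; agree = assign-cross o1 o2 cm nin refines₁ refines₂ agree }
    where open Parts g

  meets-assign : ∀ {c p} o s → Meets (after o s) p → Meets s (assign o c p)
  meets-assign {c} {p} o s (A↓ , B↓ , All↓) =
    ≤-trans (Accounted.A-paid so) (≤-trans (+-monoʳ-≤ (costA o) A↓) (≤-reflexive (sym (assign-roomA o c p)))) ,
    ≤-trans (Accounted.B-paid so) (≤-trans (+-monoʳ-≤ (costB o) B↓) (≤-reflexive (sym (assign-roomB o c p)))) ,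
    ≤-trans (Accounted.All-paid so) (≤-trans (+-monoʳ-≤ (costAll o) All↓) (≤-reflexive (sym (assign-length o c p))))
    where so = accounted o s

  parts-[] : ∀ {C} → Parts C [] [] []
  parts-[] = record { distinct₁ = dnil ; distinct₂ = dnil ; refines₁ = λ () ; refines₂ = λ () ; agree = λ () }

  allowed-R : ∀ o → Allowed tR o
  allowed-R skip = tt
  allowed-R useA = tt
  allowed-R useB = tt
  allowed-R useShared = tt
  allowed-R useSharedA = tt
  allowed-R useSharedB = tt

  joinMove-compatible : ∀ ρ → CompatibleUses JoinCompatible (joinUse₁ ρ) (joinUse₂ ρ)
  joinMove-compatible splitAB = tagged PQ
  joinMove-compatible splitBA = tagged QP
  joinMove-compatible (first o) = skip₂
  joinMove-compatible (second o) = skip₁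

  unionMove-compatible : ∀ ρ → CompatibleUses UnionCompatible (unionUse₁ ρ) (unionUse₂ ρ)
  unionMove-compatible bothA = tagged bothP
  unionMove-compatible bothB = tagged bothQ
  unionMove-compatible (first o) = skip₂
  unionMove-compatible (second o) = skip₁

  PaletteParts : (Tag → Tag → Set) → (Demand → Palette → Palette → Set) → Palette → Demand → Demand → Set
  PaletteParts C M pal s1 s2 = Σ Palette λ p1 → Σ Palette λ p2 → Parts C pal p1 p2 × M s1 pal p1 × M s2 pal p2

  record MeetsPart (s : Demand) (pal p : Palette) : Set where
    constructor part-meets
    field meets : Meets s p

  meetsPart-assign : ∀ {t c rest p} o s → MeetsPart (after o s) rest p → MeetsPart s ((t , c) ∷ rest) (assign o c p)
  meetsPart-assign o s (part-meets m) = part-meets (meets-assign o s m)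

  extendParts : ∀ {C M t c rest s1 s2 s1′ s2′} o1 o2 → Allowed t o1 → Allowed t o2 →
    CompatibleUses C o1 o2 → Unused c rest →
    (∀ {p} → M s1′ rest p → M s1 ((t , c) ∷ rest) (assign o1 c p)) →
    (∀ {p} → M s2′ rest p → M s2 ((t , c) ∷ rest) (assign o2 c p)) →
    PaletteParts C M rest s1′ s2′ → PaletteParts C M ((t , c) ∷ rest) s1 s2
  extendParts {c = c} o1 o2 al1 al2 cmp nin step1 step2 (p1 , p2 , g , m1 , m2) =
    assign o1 c p1 , assign o2 c p2 , parts-assign o1 o2 al1 al2 cmp nin g , step1 m1 , step2 m2

  splitJoin : ∀ pal → Distinct pal → ∀ s1 s2 → JoinFits s1 s2 (countP pal) (countR pal) (countQ pal) →
    PaletteParts JoinCompatible MeetsPart pal s1 s2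
  splitJoin [] _ s1 s2 h = [] , [] , parts-[] , part-meets (a₁≤0 , b₁≤0 , g₁≤) , part-meets (a₂≤0 , b₂≤0 , g₂≤)
    where
    open JoinFits h
    a₁≤0 = m+n≤o⇒m≤o (needA s1) a₁+a₂≤
    a₂≤0 = m+n≤o⇒n≤o (needA s1) a₁+a₂≤
    b₁≤0 = m+n≤o⇒m≤o (needB s1) b₁+b₂≤
    b₂≤0 = m+n≤o⇒n≤o (needB s1) b₁+b₂≤
  splitJoin ((tP , c) ∷ rest) (dcons nin d) s1 s2 h with joinStep-A s1 s2 (countP rest) (countR rest) (countQ rest) h
  ... | inj₁ h′ = extendParts {M = MeetsPart} useA skip tt tt skip₂ nin (meetsPart-assign useA s1)
      (meetsPart-assign skip s2) (splitJoin rest d (takeA s1) s2 h′)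
  ... | inj₂ h′ = extendParts {M = MeetsPart} skip useA tt tt skip₁ nin (meetsPart-assign skip s1)
      (meetsPart-assign useA s2) (splitJoin rest d s1 (takeA s2) h′)
  splitJoin ((tQ , c) ∷ rest) (dcons nin d) s1 s2 h with joinStep-B s1 s2 (countP rest) (countR rest) (countQ rest) h
  ... | inj₁ h′ = extendParts {M = MeetsPart} useB skip tt tt skip₂ nin (meetsPart-assign useB s1)
      (meetsPart-assign skip s2) (splitJoin rest d (takeB s1) s2 h′)
  ... | inj₂ h′ = extendParts {M = MeetsPart} skip useB tt tt skip₁ nin (meetsPart-assign skip s1)
      (meetsPart-assign useB s2) (splitJoin rest d s1 (takeB s2) h′)
  splitJoin ((tR , c) ∷ rest) (dcons nin d) s1 s2 h with joinStep-shared s1 s2 (countP rest) (countR rest) (countQ rest) h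
  ... | ρ , h′ = extendParts {M = MeetsPart} (joinUse₁ ρ) (joinUse₂ ρ) (allowed-R _) (allowed-R _)
      (joinMove-compatible ρ) nin
                   (meetsPart-assign (joinUse₁ ρ) s1) (meetsPart-assign (joinUse₂ ρ) s2)
                   (splitJoin rest d (after (joinUse₁ ρ) s1) (after (joinUse₂ ρ) s2) h′)

  -- In a union the A- and B-colours go to both parts and are accounted for
  -- separately: the part palette meets the remaining demand plus the
  -- A- and B-colours of the whole palette.
  record MeetsAfterShared (s : Demand) (pal p : Palette) : Set where
    constructor ⟨_,_,_⟩
    field
      A≤ : needA s + countP pal ≤ roomA p
      B≤ : needB s + countQ pal ≤ roomB p
      All≤ : needAll s + (countP pal + countQ pal) ≤ length p

  meetsAfterShared-assign : ∀ {c rest p} o s → MeetsAfterShared (after o s) rest p → MeetsAfterShared s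
      ((tR , c) ∷ rest) (assign o c p)
  meetsAfterShared-assign {c} {rest} {p} o s ⟨ A↓ , B↓ , All↓ ⟩ =
    ⟨ paid (countP rest) (Accounted.A-paid so) A↓ (assign-roomA o c p)
    ,
    paid (countQ rest) (Accounted.B-paid so) B↓ (assign-roomB o c p)
    ,
    paid (countP rest + countQ rest) (Accounted.All-paid so) All↓ (assign-length o c p) ⟩
    where
    so = accounted o s
    paid : ∀ {need cost need′ room room′} k → need ≤ cost + need′ → need′ + k ≤ room → room′ ≡ cost + room → need + k ≤ room′
    paid {cost = cost} k need≤ after≤ room′≡ =
      ≤-trans (+-monoˡ-≤ k need≤)
          (≤-trans (≤-reflexive (+-assoc cost _ k)) (≤-trans (+-monoʳ-≤ cost after≤) (≤-reflexive (sym room′≡))))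

  splitUnionShared : ∀ pal → Distinct pal → ∀ s1 s2 → SharedUnionFits s1 s2 (countR pal) →
    PaletteParts UnionCompatible MeetsAfterShared pal s1 s2
  splitUnionShared [] _ s1 s2 h =
    [] , [] , parts-[] , ⟨ +-monoˡ-≤ 0 a₁≤0 , +-monoˡ-≤ 0 b₁≤0 , +-monoˡ-≤ 0 g₁≤ ⟩ , ⟨ +-monoˡ-≤ 0 a₂≤0 , +-monoˡ-≤ 0 b₂≤0 , +-monoˡ-≤ 0 g₂≤ ⟩
    where
    open SharedUnionFits h
    a₁≤0 = m+n≤o⇒m≤o (needA s1) a₁b₂≤
    b₂≤0 = m+n≤o⇒n≤o (needA s1) a₁b₂≤
    a₂≤0 = m+n≤o⇒m≤o (needA s2) a₂b₁≤
    b₁≤0 = m+n≤o⇒n≤o (needA s2) a₂b₁≤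
  splitUnionShared ((tP , c) ∷ rest) (dcons nin d) s1 s2 h =
    extendParts {M = MeetsAfterShared} useA useA tt tt (tagged bothP) nin (P-assign s1) (P-assign s2)
        (splitUnionShared rest d s1 s2 h)
    where
    P-assign : ∀ s {p} → MeetsAfterShared s rest p → MeetsAfterShared s ((tP , c) ∷ rest) ((tP , c) ∷ p)
    P-assign s ⟨ A↓ , B↓ , All↓ ⟩ =
      ⟨ ≤-trans (≤-reflexive (+-suc (needA s) (countP rest))) (s≤s A↓) , B↓ , ≤-trans
          (≤-reflexive (+-suc (needAll s) _)) (s≤s All↓) ⟩
  splitUnionShared ((tQ , c) ∷ rest) (dcons nin d) s1 s2 h =
    extendParts {M = MeetsAfterShared} useB useB tt tt (tagged bothQ) nin (Q-assign s1) (Q-assign s2)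
        (splitUnionShared rest d s1 s2 h)
    where
    Q-assign : ∀ s {p} → MeetsAfterShared s rest p → MeetsAfterShared s ((tQ , c) ∷ rest) ((tQ , c) ∷ p)
    Q-assign s ⟨ A↓ , B↓ , All↓ ⟩ = ⟨ A↓ , ≤-trans (≤-reflexive (+-suc (needB s) (countQ rest))) (s≤s B↓) ,
      ≤-trans (≤-reflexive (trans (cong (needAll s +_) (+-suc (countP rest) (countQ rest))) (+-suc (needAll s) _)))
          (s≤s All↓) ⟩
  splitUnionShared ((tR , c) ∷ rest) (dcons nin d) s1 s2 h with unionStep s1 s2 (countR rest) h
  ... | ρ , h′ = extendParts {M = MeetsAfterShared} (unionUse₁ ρ) (unionUse₂ ρ) (allowed-R _) (allowed-R _)
      (unionMove-compatible ρ) nin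
                   (meetsAfterShared-assign (unionUse₁ ρ) s1) (meetsAfterShared-assign (unionUse₂ ρ) s2)
                   (splitUnionShared rest d (after (unionUse₁ ρ) s1) (after (unionUse₂ ρ) s2) h′)

  afterAB : Palette → Demand → Demand
  afterAB pal s = takeBs (countQ pal) (takeAs (countP pal) s)

  meets-afterAB : ∀ pal s {p} → MeetsAfterShared (afterAB pal s) pal p → Meets s p
  meets-afterAB pal s ⟨ A↓ , B↓ , All↓ ⟩ =
      ≤-trans (Paid.A-paid paidA) (≤-trans (+-monoʳ-≤ P (Paid.A-paid paidB)) (≤-trans (≤-reflexive (+-comm P _)) A↓))
    , ≤-trans (Paid.B-paid paidA) (≤-trans (Paid.B-paid paidB) (≤-trans (≤-reflexive (+-comm Q _)) B↓))
    , ≤-trans (Paid.All-paid paidA)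
        (≤-trans (+-monoʳ-≤ P (Paid.All-paid paidB)) (≤-trans (≤-reflexive (rearrange P Q _)) All↓))
    where
    P = countP pal
    Q = countQ pal
    paidA = paid-takeAs P s
    paidB = paid-takeBs Q (takeAs P s)
    rearrange : ∀ x y z → x + (y + z) ≡ z + (x + y)
    rearrange = solve-∀

  splitUnion : ∀ pal → Distinct pal → ∀ s1 s2 → UnionFits s1 s2 (countP pal) (countR pal) (countQ pal) →
    PaletteParts UnionCompatible MeetsPart pal s1 s2
  splitUnion pal d s1 s2 h =
    let (p1 , p2 , g , m1 , m2) = splitUnionShared pal d (afterAB pal s1) (afterAB pal s2)
                                    (unionFits⇒shared (unionFits-takeBs (countQ pal) (unionFits-takeAs (countP pal) h)))
    in p1 , p2 , g , part-meets (meets-afterAB pal s1 m1) , part-meets (meets-afterAB pal s2 m2)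

  record PaletteSplit (C : Tag → Tag → Set) (pal : Palette) (a₁ b₁ g₁ a₂ b₂ g₂ : ℕ) : Set where
    field
      p₁ p₂ : Palette
      out   : Parts C pal p₁ p₂
      fits₁ : Fits a₁ b₁ g₁ p₁
      fits₂ : Fits a₂ b₂ g₂ p₂

  splitPalette-union : ∀ pal → Distinct pal → ∀ {a₁ b₁ g₁ a₂ b₂ g₂} →
    SizeBounds a₁ b₁ g₁ → SizeBounds a₂ b₂ g₂ → Fits a₁ b₁ g₁ pal → Fits a₂ b₂ g₂ pal →
    a₁ + b₂ ≤ length pal → a₂ + b₁ ≤ length pal → PaletteSplit UnionCompatible pal a₁ b₁ g₁ a₂ b₂ g₂
  splitPalette-union pal d sz₁ sz₂ (a₁≤ , b₁≤ , g₁≤) (a₂≤ , b₂≤ , g₂≤) a₁b₂≤ a₂b₁≤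
    with demandOf sz₁ | demandOf sz₂
  ... | s₁ , refl , refl , refl | s₂ , refl , refl , refl =
    let (p₁ , p₂ , out , fits₁ , fits₂) = splitUnion pal d s₁ s₂ conditions
    in record { p₁ = p₁ ; p₂ = p₂ ; out = out ; fits₁ = MeetsPart.meets fits₁ ; fits₂ = MeetsPart.meets fits₂ }
    where
    A : ∀ {x} → x ≤ roomA pal → x ≤ countP pal + countR pal
    A h = ≤-trans h (≤-reflexive (roomA≡ pal))
    B : ∀ {x} → x ≤ roomB pal → x ≤ countR pal + countQ pal
    B h = ≤-trans h (≤-reflexive (roomB≡ pal))
    N : ∀ {x} → x ≤ length pal → x ≤ countP pal + countR pal + countQ pal
    N h = ≤-trans h (≤-reflexive (length≡ pal))
    conditions : UnionFits s₁ s₂ (countP pal) (countR pal) (countQ pal)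
    conditions = record { a₁≤ = A a₁≤ ; a₂≤ = A a₂≤ ; b₁≤ = B b₁≤ ; b₂≤ = B b₂≤
                        ; g₁≤ = N g₁≤ ; g₂≤ = N g₂≤ ; a₁b₂≤ = N a₁b₂≤ ; a₂b₁≤ = N a₂b₁≤ }

  splitPalette-join : ∀ pal → Distinct pal → ∀ {a₁ b₁ g₁ a₂ b₂ g₂} →
    SizeBounds a₁ b₁ g₁ → SizeBounds a₂ b₂ g₂ → a₁ + a₂ ≤ roomA pal → b₁ + b₂ ≤ roomB pal →
    g₁ ≤ length pal → g₂ ≤ length pal → PaletteSplit JoinCompatible pal a₁ b₁ g₁ a₂ b₂ g₂
  splitPalette-join pal d sz₁ sz₂ a≤ b≤ g₁≤ g₂≤ with demandOf sz₁ | demandOf sz₂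
  ... | s₁ , refl , refl , refl | s₂ , refl , refl , refl =
    let (p₁ , p₂ , out , fits₁ , fits₂) = splitJoin pal d s₁ s₂ conditions
    in record { p₁ = p₁ ; p₂ = p₂ ; out = out ; fits₁ = MeetsPart.meets fits₁ ; fits₂ = MeetsPart.meets fits₂ }
    where
    N : ∀ {x} → x ≤ length pal → x ≤ countP pal + countR pal + countQ pal
    N h = ≤-trans h (≤-reflexive (length≡ pal))
    conditions : JoinFits s₁ s₂ (countP pal) (countR pal) (countQ pal)
    conditions = record { a₁+a₂≤ = ≤-trans a≤ (≤-reflexive (roomA≡ pal)) ; b₁+b₂≤ = ≤-trans b≤ (≤-reflexive (roomB≡ pal))
                        ; g₁≤ = N g₁≤ ; g₂≤ = N g₂≤ }

  colourForA : ∀ pal → 0 < roomA pal → Σ Tag λ t → Σ ℕ λ c → (t , c) ∈ pal × Usable true t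
  colourForA ((tP , c) ∷ pal) _ = tP , c , here refl , tt
  colourForA ((tR , c) ∷ pal) _ = tR , c , here refl , tt
  colourForA ((tQ , c) ∷ pal) h = let (t , c′ , m , u) = colourForA pal h in t , c′ , there m , u

  colourForB : ∀ pal → 0 < roomB pal → Σ Tag λ t → Σ ℕ λ c → (t , c) ∈ pal × Usable false t
  colourForB ((tQ , c) ∷ pal) _ = tQ , c , here refl , tt
  colourForB ((tR , c) ∷ pal) _ = tR , c , here refl , tt
  colourForB ((tP , c) ∷ pal) h = let (t , c′ , m , u) = colourForB pal h in t , c′ , there m , u

  usable-P : ∀ {l} → Usable l tP → l ≡ true
  usable-P {true} _ = refl

  usable-Q : ∀ {l} → Usable l tQ → l ≡ false
  usable-Q {false} _ = refl

-- P4-free graphs are disconnected or co-disconnected on every vertex set with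
-- at least two vertices.
module CographDecomposition where

  open import Data.Nat using (ℕ)
  open import Data.Fin using (Fin)
  open import Data.Fin.Properties using (_≟_)
  open import Data.Bool using (Bool; true; false; not; _∧_; _∨_; _xor_)
  open import Data.Bool.Properties using (xor-identityʳ; xor-same; ∧-zeroʳ; ∧-identityʳ; ∨-zeroʳ)
  open import Data.Product using (∃; _×_; _,_; proj₂)
  open import Data.Sum using (_⊎_; inj₁; inj₂)
  open import Data.Empty using (⊥; ⊥-elim)
  open import Data.List using (List; []; _∷_)
  open import Data.List.Relation.Unary.Any using (here; there)
  open import Data.List.Membership.Propositional using (_∈_)
  open import Relation.Binary.PropositionalEquality
  open import Relation.Nullary using (¬_; yes; no)

  true≢false : true ≢ false
  true≢false ()

  ∧-true : ∀ {a b} → (a ∧ b) ≡ true → a ≡ true × b ≡ true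
  ∧-true {true} {true} _ = refl , refl

  ∧-false : ∀ {a b} → (a ∧ b) ≡ false → a ≡ true → b ≡ false
  ∧-false {true} e refl = e

  ∨-false : ∀ {a b} → (a ∨ b) ≡ false → a ≡ false × b ≡ false
  ∨-false {false} {false} _ = refl , refl

  ∨-true : ∀ {a b} → (a ∨ b) ≡ true → b ≡ false → a ≡ true
  ∨-true {true}  _ _    = refl
  ∨-true {false} e refl = e

  not-true : ∀ {a} → not a ≡ true → a ≡ false
  not-true {false} _ = refl

  not-false : ∀ {a} → not a ≡ false → a ≡ true
  not-false {true} _ = refl

  allOrCounterexample : ∀ {A : Set} (f : A → Bool) (xs : List A) →
    (∀ {v} → v ∈ xs → f v ≡ true) ⊎ (∃ λ v → v ∈ xs × f v ≡ false)
  allOrCounterexample f [] = inj₁ (λ ())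
  allOrCounterexample f (x ∷ xs) with f x in fx | allOrCounterexample f xs
  ... | false | _                  = inj₂ (x , here refl , fx)
  ... | true  | inj₁ all          = inj₁ λ { (here refl) → fx ; (there m) → all m }
  ... | true  | inj₂ (v , m , fv) = inj₂ (v , there m , fv)

  module _ {n : ℕ} where

    _==_ : Fin n → Fin n → Bool
    a == b with a ≟ b
    ... | yes _ = true
    ... | no _  = false

    ==-refl : ∀ a → (a == a) ≡ true
    ==-refl a with a ≟ a
    ... | yes _ = refl
    ... | no a≢a = ⊥-elim (a≢a refl)

    ==⇒≡ : ∀ {a b} → (a == b) ≡ true → a ≡ b
    ==⇒≡ {a} {b} e with a ≟ b
    ... | yes a≡b = a≡b
    ... | no _    = ⊥-elim (true≢false (sym e))

    ≢⇒==false : ∀ {a b} → a ≢ b → (a == b) ≡ false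
    ≢⇒==false {a} {b} a≢b with a ≟ b
    ... | yes a≡b = ⊥-elim (a≢b a≡b)
    ... | no _    = refl

    ==false⇒≢ : ∀ {a b} → (a == b) ≡ false → a ≢ b
    ==false⇒≢ {a} e refl = true≢false (trans (sym (==-refl a)) e)

    ∈-tail : ∀ {u x : Fin n} {W} → u ∈ x ∷ W → (u == x) ≡ false → u ∈ W
    ∈-tail (here refl) e = ⊥-elim (==false⇒≢ e refl)
    ∈-tail (there m)   _ = m

    ∈-shrink : ∀ {u x : Fin n} {W} → x ∈ W → u ∈ x ∷ W → u ∈ W
    ∈-shrink x∈W (here refl) = x∈W
    ∈-shrink _   (there m)   = m

    memberOfTail : ∀ {x u v : Fin n} {W} → u ∈ x ∷ W → v ∈ x ∷ W → u ≢ v → ∃ λ y → y ∈ W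
    memberOfTail {x} {u} u∈ v∈ u≢v with u ≟ x
    ... | no u≢x   = u , ∈-tail u∈ (≢⇒==false u≢x)
    ... | yes refl = _ , ∈-tail v∈ (≢⇒==false (λ v≡x → u≢v (sym v≡x)))

  NoP4 : ∀ {n} → (Fin n → Fin n → Bool) → Set
  NoP4 {n} K = ∀ (a b c d : Fin n) → K a b ≡ true → K b c ≡ true → K c d ≡ true →
    K a c ≡ false → K b d ≡ false → K a d ≡ false → ⊥

  module Decomposition {n : ℕ} (H : Fin n → Fin n → Bool)
                       (H-sym : ∀ x y → H x y ≡ H y x) (noP4 : NoP4 H) where

    record Split (W : List (Fin n)) : Set where
      field
        side  : Fin n → Bool
        β     : Bool
        left  : ∃ λ u → u ∈ W × side u ≡ true
        right : ∃ λ w → w ∈ W × side w ≡ false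
        cross : ∀ u w → u ∈ W → w ∈ W → side u ≡ true → side w ≡ false → H u w ≡ β

    open Split public

    -- differs β u w: the H-adjacency of u and w is not β.  For β = true this is
    -- the complement of H, which is P4-free again because P4 is self-complementary.
    differs : Bool → Fin n → Fin n → Bool
    differs β u w = H u w xor β

    differs-sym : ∀ β u w → differs β u w ≡ differs β w u
    differs-sym β u w = cong (_xor β) (H-sym u w)

    differs-false : ∀ {β u w} → differs β u w ≡ false → H u w ≡ β
    differs-false {false} {u} {w} e = trans (sym (xor-identityʳ (H u w))) e
    differs-false {true}  {u} {w} e with H u w
    ... | true = refl

    differs-true : ∀ {β u w} → differs β u w ≡ true → H u w ≡ not β
    differs-true {false} {u} {w} e = trans (sym (xor-identityʳ (H u w))) e
    differs-true {true}  {u} {w} e with H u w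
    ... | false = refl

    same⇒¬differs : ∀ {β u w} → H u w ≡ β → differs β u w ≡ false
    same⇒¬differs {β} e = trans (cong (_xor β) e) (xor-same β)

    noP4-differs : ∀ β → NoP4 (differs β)
    noP4-differs false a b c d ab bc cd ac bd ad =
      noP4 a b c d (h ab) (h bc) (h cd) (h ac) (h bd) (h ad)
      where h : ∀ {u w x} → H u w xor false ≡ x → H u w ≡ x
            h {u} {w} e = trans (sym (xor-identityʳ (H u w))) e
    noP4-differs true a b c d ab bc cd ac bd ad =
      noP4 c a d b (trans (H-sym c a) (differs-false ac)) (differs-false ad)
                   (trans (H-sym d b) (differs-false bd)) (differs-true cd)
                   (differs-true ab) (trans (H-sym c b) (differs-true bc))

    split-duplicate : ∀ {x W} → x ∈ W → Split W → Split (x ∷ W)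
    split-duplicate x∈W sp = record
      { side = side sp ; β = β sp
      ; left  = let (u , m , e) = left sp  in u , there m , e
      ; right = let (w , m , e) = right sp in w , there m , e
      ; cross = λ u w mu mw → cross sp u w (∈-shrink x∈W mu) (∈-shrink x∈W mw) }

    Fresh : Fin n → List (Fin n) → Set
    Fresh x W = ∀ {v} → v ∈ W → (v == x) ≡ false

    split-off : ∀ {x W} β → (∃ λ w → w ∈ W) → Fresh x W →
      (∀ {v} → v ∈ W → H x v ≡ β) → Split (x ∷ W)
    split-off {x} β (w₀ , w₀∈W) fresh constant = record
      { side = _== x ; β = β
      ; left  = x , here refl , ==-refl x
      ; right = w₀ , there w₀∈W , fresh w₀∈W
      ; cross = λ u w _ w∈ u==x w==x →
          subst (λ y → H y w ≡ β) (sym (==⇒≡ u==x)) (constant (∈-tail w∈ w==x)) }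

    split-joinRight : ∀ {x W} → Fresh x W → (sp : Split W) →
      (∀ {v} → v ∈ W → side sp v ≡ true → H v x ≡ β sp) → Split (x ∷ W)
    split-joinRight {x} {W} fresh sp toLeft = record
      { side = λ v → side sp v ∧ not (v == x) ; β = β sp
      ; left  = let (u , u∈W , su) = left sp in
                u , there u∈W , cong₂ (λ a b → a ∧ not b) su (fresh u∈W)
      ; right = x , here refl , trans (cong (λ b → side sp x ∧ not b) (==-refl x)) (∧-zeroʳ (side sp x))
      ; cross = crossing }
      where
      crossing : ∀ u w → u ∈ x ∷ W → w ∈ x ∷ W → (side sp u ∧ not (u == x)) ≡ true →
                 (side sp w ∧ not (w == x)) ≡ false → H u w ≡ β sp
      crossing u w u∈ w∈ su sw with ∧-true {side sp u} su | w == x in w==x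
      ... | su′ , u≠x | true  = subst (λ y → H u y ≡ β sp) (sym (==⇒≡ w==x)) (toLeft (∈-tail u∈ (not-true u≠x)) su′)
      ... | su′ , u≠x | false = cross sp u w (∈-tail u∈ (not-true u≠x)) (∈-tail w∈ w==x) su′
          (trans (sym (∧-identityʳ (side sp w))) sw)

    split-joinLeft : ∀ {x W} → Fresh x W → (sp : Split W) →
      (∀ {v} → v ∈ W → side sp v ≡ false → H x v ≡ β sp) → Split (x ∷ W)
    split-joinLeft {x} {W} fresh sp toRight = record
      { side = λ v → side sp v ∨ (v == x) ; β = β sp
      ; left  = x , here refl , trans (cong (side sp x ∨_) (==-refl x)) (∨-zeroʳ (side sp x))
      ; right = let (w , w∈W , sw) = right sp in
                w , there w∈W , cong₂ _∨_ sw (fresh w∈W)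
      ; cross = crossing }
      where
      crossing : ∀ u w → u ∈ x ∷ W → w ∈ x ∷ W → (side sp u ∨ (u == x)) ≡ true →
                 (side sp w ∨ (w == x)) ≡ false → H u w ≡ β sp
      crossing u w u∈ w∈ su sw with ∨-false {side sp w} sw | u == x in u==x
      ... | sw′ , w≠x | true  = subst (λ y → H y w ≡ β sp) (sym (==⇒≡ u==x)) (toRight (∈-tail w∈ w≠x) sw′)
      ... | sw′ , w≠x | false = cross sp u w (∈-tail u∈ u==x) (∈-tail w∈ w≠x) (∨-true su refl) sw′

    -- Otherwise x differs from β towards some u₀ on the left and some z₀ on the
    -- right.  Then, P4-freeness forces the vertices y with H x y = β (there is
    -- at least one, y₀) to have H-adjacency β to x and to all other vertices.
    split-regroup : ∀ {x W} → Fresh x W → (sp : Split W) →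
      (∃ λ y₀ → y₀ ∈ W × differs (β sp) x y₀ ≡ false) →
      (∃ λ u₀ → u₀ ∈ W × side sp u₀ ≡ true × differs (β sp) x u₀ ≡ true) →
      (∃ λ z₀ → z₀ ∈ W × side sp z₀ ≡ false × differs (β sp) x z₀ ≡ true) → Split (x ∷ W)
    split-regroup {x} {W} fresh sp (y₀ , y₀∈W , xy₀) (u₀ , u₀∈W , su₀ , xu₀) (z₀ , z₀∈W , sz₀ , xz₀) = record
      { side = λ v → not (differs b x v) ∧ not (v == x) ; β = b
      ; left  = y₀ , there y₀∈W , cong₂ (λ p q → not p ∧ not q) xy₀ (fresh y₀∈W)
      ; right = x , here refl , trans (cong (λ q → not (differs b x x) ∧ not q) (==-refl x)) (∧-zeroʳ _)
      ; cross = crossing }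
      where
      b = β sp
      across : ∀ {p q} → p ∈ W → q ∈ W → side sp p ≡ true → side sp q ≡ false → differs b p q ≡ false
      across p∈ q∈ sp′ sq = same⇒¬differs (cross sp _ _ p∈ q∈ sp′ sq)
      -- u is like y₀ and w like x; a differing pair u w would close an induced P4
      agree : ∀ u w → u ∈ W → w ∈ W → differs b x u ≡ false → differs b x w ≡ true → differs b u w ≡ false
      agree u w u∈ w∈ xu xw with differs b u w in uw | side sp u in su | side sp w in sw
      ... | false | _     | _     = refl
      ... | true  | true  | false = ⊥-elim (true≢false (trans (sym uw) (across u∈ w∈ su sw)))
      ... | true  | false | true  = ⊥-elim (true≢false (trans (sym uw) (trans (differs-sym b u w) (across w∈ u∈ sw su))))
      ... | true  | true  | true  = ⊥-elim (noP4-differs b u w x z₀ uw (trans (differs-sym b w x) xw) xz₀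
                                      (trans (differs-sym b u x) xu) (across w∈ z₀∈W sw sz₀) (across u∈ z₀∈W su sz₀))
      ... | true  | false | false = ⊥-elim (noP4-differs b u w x u₀ uw (trans (differs-sym b w x) xw) xu₀
                                      (trans (differs-sym b u x) xu) (trans (differs-sym b w u₀) (across u₀∈W w∈ su₀ sw))
                                      (trans (differs-sym b u u₀) (across u₀∈W u∈ su₀ su)))
      crossing : ∀ u w → u ∈ x ∷ W → w ∈ x ∷ W → (not (differs b x u) ∧ not (u == x)) ≡ true →
                 (not (differs b x w) ∧ not (w == x)) ≡ false → H u w ≡ b
      crossing u w u∈ w∈ su sw with ∧-true {not (differs b x u)} su | w == x in w==x
      ... | xu , u≠x | true  = subst (λ y → H u y ≡ b) (sym (==⇒≡ w==x))
                                 (trans (H-sym u x) (differs-false (not-true xu)))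
      ... | xu , u≠x | false = differs-false (agree u w (∈-tail u∈ (not-true u≠x)) (∈-tail w∈ w==x) (not-true xu)
                                 (not-false (trans (sym (∧-identityʳ _)) sw)))

    insert : ∀ {x W} → Fresh x W → Split W → Split (x ∷ W)
    insert {x} {W} fresh sp with allOrCounterexample (differs (β sp) x) W
    ... | inj₁ allDiffer =
      split-off (not (β sp)) (let (u , u∈W , _) = left sp in u , u∈W) fresh (λ v∈ → differs-true (allDiffer v∈))
    ... | inj₂ y₀ with allOrCounterexample (λ v → not (side sp v ∧ differs (β sp) x v)) W
    ...   | inj₁ leftSame =
      split-joinRight fresh sp (λ v∈ sv → trans (H-sym _ x) (differs-false (∧-false (not-true (leftSame v∈)) sv)))
    ...   | inj₂ (u₀ , u₀∈W , e) with ∧-true (not-false e)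
                                    | allOrCounterexample (λ v → not (not (side sp v) ∧ differs (β sp) x v)) W
    ...     | su₀ , xu₀ | inj₁ rightSame =
      split-joinLeft fresh sp (λ v∈ sv → differs-false (∧-false (not-true (rightSame v∈)) (cong not sv)))
    ...     | su₀ , xu₀ | inj₂ (z₀ , z₀∈W , e′) with ∧-true (not-false e′)
    ...       | nsz₀ , xz₀ = split-regroup fresh sp y₀ (u₀ , u₀∈W , su₀ , xu₀) (z₀ , z₀∈W , not-true nsz₀ , xz₀)

    mutual
      split : ∀ W {u v} → u ∈ W → v ∈ W → u ≢ v → Split W
      split (x ∷ W) u∈ v∈ u≢v with allOrCounterexample (λ z → not (z == x)) W
      ... | inj₂ (z , z∈W , z==x) =
        split-duplicate x∈W (split W (∈-shrink x∈W u∈) (∈-shrink x∈W v∈) u≢v)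
        where x∈W = subst (_∈ W) (==⇒≡ (not-false z==x)) z∈W
      ... | inj₁ notX = splitFresh (λ m → not-true (notX m)) (proj₂ (memberOfTail u∈ v∈ u≢v))

      splitFresh : ∀ {x y W} → Fresh x W → y ∈ W → Split (x ∷ W)
      splitFresh {x} {y} {W} fresh y∈W with allOrCounterexample (_== y) W
      ... | inj₁ allY = split-off (H x y) (y , y∈W) fresh (λ v∈W → cong (H x) (==⇒≡ (allY v∈W)))
      ... | inj₂ (z , z∈W , z≠y) = insert fresh (split W y∈W z∈W (λ y≡z → ==false⇒≢ z≠y (sym y≡z)))

-- Cliques and palette colourings of a labelled graph whose switch is a
-- cograph, built along the cograph decomposition.
module LabelledColouring where

  open import Data.Nat using (ℕ; zero; suc; _+_; _≤_; _<_; _⊔_; z≤n; s≤s)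
  open import Data.Nat.Properties
  open import Data.Fin using (Fin)
  open import Data.Bool using (Bool; true; false; _xor_)
  import Data.Bool.Properties as Bool
  open import Data.Product using (Σ; _×_; _,_; proj₁; proj₂)
  open import Data.Sum using (inj₁; inj₂; [_,_]′)
  open import Data.Empty using (⊥)
  open import Data.Unit using (⊤; tt)
  open import Data.List using (List; []; _∷_; length; filter; _++_)
  open import Data.List.Properties using (length-++; filter-notAll)
  open import Data.List.Relation.Unary.Any using (here; there)
  open import Data.List.Relation.Unary.All as All using (All)
  open import Data.List.Relation.Unary.AllPairs using (AllPairs; []; _∷_)
  import Data.List.Relation.Unary.AllPairs.Properties as AllPairs
  open import Data.List.Membership.Propositional using (_∈_; lose)
  open import Data.List.Membership.Propositional.Properties using (∈-filter⁺; ∈-filter⁻; ∈-++⁻)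
  open import Relation.Binary.PropositionalEquality
  open import Relation.Nullary using (yes; no)
  open Demands
  open Palettes
  open CographDecomposition

  switch : ∀ {V : Set} → (V → V → Bool) → (V → Bool) → V → V → Bool
  switch E ℓ x y = E x y xor (ℓ x xor ℓ y)

  switch-involutive : ∀ {V : Set} (E : V → V → Bool) (ℓ : V → Bool) x y →
    switch (switch E ℓ) ℓ x y ≡ E x y
  switch-involutive E ℓ x y = begin
    (E x y xor d) xor d   ≡⟨ Bool.xor-assoc (E x y) d d ⟩
    E x y xor (d xor d)   ≡⟨ cong (E x y xor_) (Bool.xor-same d) ⟩
    E x y xor false       ≡⟨ Bool.xor-identityʳ (E x y) ⟩
    E x y                 ∎
    where
    open ≡-Reasoning
    d = ℓ x xor ℓ y

  longer : ∀ {A : Set} → List A → List A → List A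
  longer xs ys with length xs ≤? length ys
  ... | yes _ = ys
  ... | no _  = xs

  length-longer : ∀ {A : Set} (xs ys : List A) → length (longer xs ys) ≡ length xs ⊔ length ys
  length-longer xs ys with length xs ≤? length ys
  ... | yes xs≤ys = sym (m≤n⇒m⊔n≡n xs≤ys)
  ... | no  xs≰ys = sym (m≥n⇒m⊔n≡m (≰⇒≥ xs≰ys))

  |longer| : ∀ {A : Set} (xs ys : List A) {m k} → length xs ≡ m → length ys ≡ k → length (longer xs ys) ≡ m ⊔ k
  |longer| xs ys |xs| |ys| = trans (length-longer xs ys) (cong₂ _⊔_ |xs| |ys|)

  |++| : ∀ {A : Set} (xs : List A) {ys : List A} {m k} → length xs ≡ m → length ys ≡ k → length (xs ++ ys) ≡ m + k
  |++| xs {ys} |xs| |ys| = trans (length-++ xs) (cong₂ _+_ |xs| |ys|)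

  longer-preserves : ∀ {A : Set} (P : List A → Set) {xs ys} → P xs → P ys → P (longer xs ys)
  longer-preserves P {xs} {ys} pxs pys with length xs ≤? length ys
  ... | yes _ = pys
  ... | no _  = pxs

  -- The sizes of a disjoint union-like composition: the largest cliques come
  -- from one part, or combine a label-true clique of one part with a
  -- label-false clique of the other.
  unionSizes : ∀ {a₁ b₁ g₁ a₂ b₂ g₂} → SizeBounds a₁ b₁ g₁ → SizeBounds a₂ b₂ g₂ →
    SizeBounds (a₁ ⊔ a₂) (b₁ ⊔ b₂) ((g₁ ⊔ g₂) ⊔ ((a₁ + b₂) ⊔ (a₂ + b₁)))
  unionSizes {a₁} {b₁} {g₁} {a₂} {b₂} {g₂} (a₁≤g₁ , b₁≤g₁ , g₁≤) (a₂≤g₂ , b₂≤g₂ , g₂≤) =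
      m≤n⇒m≤n⊔o ((a₁ + b₂) ⊔ (a₂ + b₁)) (⊔-mono-≤ a₁≤g₁ a₂≤g₂)
    , m≤n⇒m≤n⊔o ((a₁ + b₂) ⊔ (a₂ + b₁)) (⊔-mono-≤ b₁≤g₁ b₂≤g₂)
    , ⊔-lub (⊔-lub (≤-trans g₁≤ (+-mono-≤ (m≤m⊔n a₁ a₂) (m≤m⊔n b₁ b₂)))
                   (≤-trans g₂≤ (+-mono-≤ (m≤n⊔m a₁ a₂) (m≤n⊔m b₁ b₂))))
            (⊔-lub (+-mono-≤ (m≤m⊔n a₁ a₂) (m≤n⊔m b₁ b₂))
                   (+-mono-≤ (m≤n⊔m a₁ a₂) (m≤m⊔n b₁ b₂)))

  -- The sizes of a join-like composition: label-true cliques of the two parts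
  -- combine, and so do label-false cliques.
  joinSizes : ∀ {a₁ b₁ g₁ a₂ b₂ g₂} → SizeBounds a₁ b₁ g₁ → SizeBounds a₂ b₂ g₂ →
    SizeBounds (a₁ + a₂) (b₁ + b₂) ((g₁ ⊔ g₂) ⊔ ((a₁ + a₂) ⊔ (b₁ + b₂)))
  joinSizes {a₁} {b₁} {g₁} {a₂} {b₂} {g₂} (_ , _ , g₁≤) (_ , _ , g₂≤) =
      m≤n⇒m≤o⊔n (g₁ ⊔ g₂) (m≤m⊔n (a₁ + a₂) (b₁ + b₂))
    , m≤n⇒m≤o⊔n (g₁ ⊔ g₂) (m≤n⊔m (a₁ + a₂) (b₁ + b₂))
    , ⊔-lub (⊔-lub (≤-trans g₁≤ (+-mono-≤ (m≤m+n a₁ a₂) (m≤m+n b₁ b₂)))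
                   (≤-trans g₂≤ (+-mono-≤ (m≤n+m a₂ a₁) (m≤n+m b₂ b₁))))
            (⊔-lub (m≤m+n (a₁ + a₂) (b₁ + b₂)) (m≤n+m (b₁ + b₂) (a₁ + a₂)))

  module Labelled {n : ℕ} (E : Fin n → Fin n → Bool) (E-sym : ∀ x y → E x y ≡ E y x)
                  (E-irrefl : ∀ x → E x x ≡ false) (ℓ : Fin n → Bool) where

    H : Fin n → Fin n → Bool
    H = switch E ℓ

    H-sym : ∀ x y → H x y ≡ H y x
    H-sym x y = cong₂ _xor_ (E-sym x y) (Bool.xor-comm (ℓ x) (ℓ y))

    Adj : Fin n → Fin n → Set
    Adj x y = E x y ≡ true

    E-from-H : ∀ {u w b} → H u w ≡ b → E u w ≡ b xor (ℓ u xor ℓ w)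
    E-from-H {u} {w} e = trans (sym (switch-involutive E ℓ u w)) (cong (_xor (ℓ u xor ℓ w)) e)

    PaletteColouring : List (Fin n) → Palette → Set
    PaletteColouring W pal = Σ (Fin n → ℕ) λ c →
        (∀ v → v ∈ W → Σ Tag λ t → (t , c v) ∈ pal × Usable (ℓ v) t)
      × (∀ u v → u ∈ W → v ∈ W → Adj u v → c u ≢ c v)

    ColourableFrom : List (Fin n) → ℕ → ℕ → ℕ → Set
    ColourableFrom W a b g = ∀ pal → Distinct pal → Fits a b g pal → PaletteColouring W pal

    record Clique (W : List (Fin n)) (lab : Fin n → Set) (K : List (Fin n)) : Set where
      field
        ⊆W       : ∀ {v} → v ∈ K → v ∈ W
        labelled : ∀ {v} → v ∈ K → lab v
        pairwise : AllPairs Adj K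

    open Clique public

    IsA IsB Anything : Fin n → Set
    IsA v      = ℓ v ≡ true
    IsB v      = ℓ v ≡ false
    Anything v = ⊤

    -- The labelled strengthening of χ = ω for the vertex set W: cliques of
    -- sizes a, b, g (label true, label false, any) such that W can be coloured
    -- from any palette into which a, b, g fit.
    record Block (W : List (Fin n)) : Set where
      field
        a b g      : ℕ
        KA KB KG   : List (Fin n)
        |KA|       : length KA ≡ a
        |KB|       : length KB ≡ b
        |KG|       : length KG ≡ g
        KA-clique  : Clique W IsA KA
        KB-clique  : Clique W IsB KB
        KG-clique  : Clique W Anything KG
        sizes      : SizeBounds a b g
        colourable : ColourableFrom W a b g

    emptyClique : ∀ {W lab} → Clique W lab []
    emptyClique = record { ⊆W = λ () ; labelled = λ () ; pairwise = [] }

    singletonClique : ∀ {W lab x} → x ∈ W → lab x → Clique W lab (x ∷ [])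
    singletonClique x∈W lx = record
      { ⊆W = λ { (here refl) → x∈W } ; labelled = λ { (here refl) → lx } ; pairwise = All.[] ∷ [] }

    clique-⊆ : ∀ {W₁ W lab K} → (∀ {v} → v ∈ W₁ → v ∈ W) → Clique W₁ lab K → Clique W lab K
    clique-⊆ sub c = record { ⊆W = λ m → sub (⊆W c m) ; labelled = labelled c ; pairwise = pairwise c }

    clique-forget : ∀ {W lab K} → Clique W lab K → Clique W Anything K
    clique-forget c = record { ⊆W = ⊆W c ; labelled = λ _ → tt ; pairwise = pairwise c }

    clique-++ : ∀ {W lab K₁ K₂} → Clique W lab K₁ → Clique W lab K₂ →
      (∀ {u v} → u ∈ K₁ → v ∈ K₂ → Adj u v) → Clique W lab (K₁ ++ K₂)
    clique-++ {K₁ = K₁} c₁ c₂ joined = record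
      { ⊆W       = λ m → [ ⊆W c₁ , ⊆W c₂ ]′ (∈-++⁻ K₁ m)
      ; labelled = λ m → [ labelled c₁ , labelled c₂ ]′ (∈-++⁻ K₁ m)
      ; pairwise = AllPairs.++⁺ (pairwise c₁) (pairwise c₂)
                     (All.tabulate λ u∈ → All.tabulate λ v∈ → joined u∈ v∈) }

    emptyBlock : Block []
    emptyBlock = record
      { a = 0 ; b = 0 ; g = 0 ; KA = [] ; KB = [] ; KG = [] ; |KA| = refl ; |KB| = refl ; |KG| = refl
      ; KA-clique = emptyClique ; KB-clique = emptyClique ; KG-clique = emptyClique
      ; sizes = z≤n , z≤n , z≤n
      ; colourable = λ _ _ _ → (λ _ → 0) , (λ _ ()) , (λ _ _ ()) }

    constantColouring : ∀ {W x t c pal} → (∀ {v} → v ∈ W → v ≡ x) → (t , c) ∈ pal → Usable (ℓ x) t →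
      PaletteColouring W pal
    constantColouring {x = x} {t} {c} allX c∈ usable =
        (λ _ → c)
      , (λ v v∈ → t , c∈ , subst (λ y → Usable (ℓ y) t) (sym (allX v∈)) usable)
      , (λ u v u∈ v∈ adj _ → true≢false (trans (sym (subst₂ Adj (allX u∈) (allX v∈) adj)) (E-irrefl x)))

    singletonBlock : ∀ {x W} → x ∈ W → (∀ {v} → v ∈ W → v ≡ x) → Block W
    singletonBlock {x} {W} x∈W allX with ℓ x in ℓx
    ... | true = record
      { a = 1 ; b = 0 ; g = 1 ; KA = x ∷ [] ; KB = [] ; KG = x ∷ [] ; |KA| = refl ; |KB| = refl ; |KG| = refl
      ; KA-clique = singletonClique x∈W ℓx ; KB-clique = emptyClique ; KG-clique = singletonClique x∈W tt
      ; sizes = s≤s z≤n , z≤n , s≤s z≤n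
      ; colourable = λ pal _ (A-room , _ , _) →
          let (t , c , c∈ , usable) = colourForA pal A-room
          in constantColouring allX c∈ (subst (λ l → Usable l t) (sym ℓx) usable) }
    ... | false = record
      { a = 0 ; b = 1 ; g = 1 ; KA = [] ; KB = x ∷ [] ; KG = x ∷ [] ; |KA| = refl ; |KB| = refl ; |KG| = refl
      ; KA-clique = emptyClique ; KB-clique = singletonClique x∈W ℓx ; KG-clique = singletonClique x∈W tt
      ; sizes = z≤n , s≤s z≤n , s≤s z≤n
      ; colourable = λ pal _ (_ , B-room , _) →
          let (t , c , c∈ , usable) = colourForB pal B-room
          in constantColouring allX c∈ (subst (λ l → Usable l t) (sym ℓx) usable) }

    module Composition (W : List (Fin n)) (side : Fin n → Bool) (β : Bool)
      (cross : ∀ u w → u ∈ W → w ∈ W → side u ≡ true → side w ≡ false → H u w ≡ β) where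

      W₁ W₂ : List (Fin n)
      W₁ = filter (λ v → side v Bool.≟ true) W
      W₂ = filter (λ v → side v Bool.≟ false) W

      ∈W₁ : ∀ {v} → v ∈ W₁ → v ∈ W × side v ≡ true
      ∈W₁ = ∈-filter⁻ (λ v → side v Bool.≟ true)

      ∈W₂ : ∀ {v} → v ∈ W₂ → v ∈ W × side v ≡ false
      ∈W₂ = ∈-filter⁻ (λ v → side v Bool.≟ false)

      W₁⊆W : ∀ {v} → v ∈ W₁ → v ∈ W
      W₁⊆W m = proj₁ (∈W₁ m)

      W₂⊆W : ∀ {v} → v ∈ W₂ → v ∈ W
      W₂⊆W m = proj₁ (∈W₂ m)

      across : ∀ {u w} → u ∈ W₁ → w ∈ W₂ → E u w ≡ β xor (ℓ u xor ℓ w)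
      across u∈ w∈ = E-from-H (cross _ _ (proj₁ (∈W₁ u∈)) (proj₁ (∈W₂ w∈)) (proj₂ (∈W₁ u∈)) (proj₂ (∈W₂ w∈)))

      across-labelled : ∀ {u w lu lw} → u ∈ W₁ → w ∈ W₂ → ℓ u ≡ lu → ℓ w ≡ lw → E u w ≡ β xor (lu xor lw)
      across-labelled u∈ w∈ ℓu ℓw = trans (across u∈ w∈) (cong₂ (λ x y → β xor (x xor y)) ℓu ℓw)

      Compatible : (Tag → Tag → Set) → Set
      Compatible C = ∀ {u v t₁ t₂} → u ∈ W₁ → v ∈ W₂ → Adj u v → C t₁ t₂ → Usable (ℓ u) t₁ → Usable (ℓ v) t₂ → ⊥

      combine : ∀ {C pal p₁ p₂} → Parts C pal p₁ p₂ → Compatible C →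
        PaletteColouring W₁ p₁ → PaletteColouring W₂ p₂ → PaletteColouring W pal
      combine {pal = pal} {p₂ = p₂} out compatible (c₁ , valid₁ , proper₁) (c₂ , valid₂ , proper₂) = c , valid , proper
        where
        open Parts out
        c : Fin n → ℕ
        c v with side v
        ... | true  = c₁ v
        ... | false = c₂ v
        valid : ∀ v → v ∈ W → Σ Tag λ t → (t , c v) ∈ pal × Usable (ℓ v) t
        valid v v∈ with side v in sv
        ... | true  = let (t , m , u) = valid₁ v (∈-filter⁺ _ v∈ sv) ; (t′ , m′ , t⊑t′) = refines₁ m
                      in t′ , m′ , usable⊑ {ℓ v} t⊑t′ u
        ... | false = let (t , m , u) = valid₂ v (∈-filter⁺ _ v∈ sv) ; (t′ , m′ , t⊑t′) = refines₂ m
                      in t′ , m′ , usable⊑ {ℓ v} t⊑t′ u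
        clash : ∀ {u v} → u ∈ W₁ → v ∈ W₂ → Adj u v → c₁ u ≡ c₂ v → ⊥
        clash {u} {v} u∈ v∈ adj same =
          let (t₁ , m₁ , us₁) = valid₁ u u∈ ; (t₂ , m₂ , us₂) = valid₂ v v∈
          in compatible u∈ v∈ adj (agree m₁ (subst (λ x → (t₂ , x) ∈ p₂) (sym same) m₂)) us₁ us₂
        proper : ∀ u v → u ∈ W → v ∈ W → Adj u v → c u ≢ c v
        proper u v u∈ v∈ adj with side u in su | side v in sv
        ... | true  | true  = proper₁ u v (∈-filter⁺ _ u∈ su) (∈-filter⁺ _ v∈ sv) adj
        ... | false | false = proper₂ u v (∈-filter⁺ _ u∈ su) (∈-filter⁺ _ v∈ sv) adj
        ... | true  | false = clash (∈-filter⁺ _ u∈ su) (∈-filter⁺ _ v∈ sv) adj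
        ... | false | true  = λ e → clash (∈-filter⁺ _ v∈ sv) (∈-filter⁺ _ u∈ su) (trans (E-sym v u) adj) (sym e)

      compatible-union : β ≡ false → Compatible UnionCompatible
      compatible-union refl {u} {v} u∈ v∈ adj bothP us₁ us₂ =
        true≢false (trans (sym adj) (across-labelled u∈ v∈ (usable-P {ℓ u} us₁) (usable-P {ℓ v} us₂)))
      compatible-union refl {u} {v} u∈ v∈ adj bothQ us₁ us₂ =
        true≢false (trans (sym adj) (across-labelled u∈ v∈ (usable-Q {ℓ u} us₁) (usable-Q {ℓ v} us₂)))

      compatible-join : β ≡ true → Compatible JoinCompatible
      compatible-join refl {u} {v} u∈ v∈ adj PQ us₁ us₂ =
        true≢false (trans (sym adj) (across-labelled u∈ v∈ (usable-P {ℓ u} us₁) (usable-Q {ℓ v} us₂)))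
      compatible-join refl {u} {v} u∈ v∈ adj QP us₁ us₂ =
        true≢false (trans (sym adj) (across-labelled u∈ v∈ (usable-Q {ℓ u} us₁) (usable-P {ℓ v} us₂)))

      module _ (B₁ : Block W₁) (B₂ : Block W₂) where
        private
          module B₁ = Block B₁
          module B₂ = Block B₂

        union-joined₁₂ : β ≡ false → ∀ {u v} → u ∈ B₁.KA → v ∈ B₂.KB → Adj u v
        union-joined₁₂ refl u∈ v∈ = across-labelled (⊆W B₁.KA-clique u∈) (⊆W B₂.KB-clique v∈)
                                      (labelled B₁.KA-clique u∈) (labelled B₂.KB-clique v∈)

        union-joined₂₁ : β ≡ false → ∀ {u v} → u ∈ B₂.KA → v ∈ B₁.KB → Adj u v
        union-joined₂₁ refl u∈ v∈ = trans (E-sym _ _) (across-labelled (⊆W B₁.KB-clique v∈) (⊆W B₂.KA-clique u∈)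
                                      (labelled B₁.KB-clique v∈) (labelled B₂.KA-clique u∈))

        join-joinedA : β ≡ true → ∀ {u v} → u ∈ B₁.KA → v ∈ B₂.KA → Adj u v
        join-joinedA refl u∈ v∈ = across-labelled (⊆W B₁.KA-clique u∈) (⊆W B₂.KA-clique v∈)
                                    (labelled B₁.KA-clique u∈) (labelled B₂.KA-clique v∈)

        join-joinedB : β ≡ true → ∀ {u v} → u ∈ B₁.KB → v ∈ B₂.KB → Adj u v
        join-joinedB refl u∈ v∈ = across-labelled (⊆W B₁.KB-clique u∈) (⊆W B₂.KB-clique v∈)
                                    (labelled B₁.KB-clique u∈) (labelled B₂.KB-clique v∈)

        union-colourable : β ≡ false →
          ColourableFrom W (B₁.a ⊔ B₂.a) (B₁.b ⊔ B₂.b) ((B₁.g ⊔ B₂.g) ⊔ ((B₁.a + B₂.b) ⊔ (B₂.a + B₁.b)))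
        union-colourable β≡false pal d (a≤ , b≤ , g≤) =
          combine out (compatible-union β≡false) (B₁.colourable p₁ (Parts.distinct₁ out) fits₁)
                                                 (B₂.colourable p₂ (Parts.distinct₂ out) fits₂)
          where
          part≤ : ∀ {x} → x ≤ B₁.g ⊔ B₂.g → x ≤ length pal
          part≤ h = ≤-trans (m≤n⇒m≤n⊔o _ h) g≤
          mixed≤ : ∀ {x} → x ≤ (B₁.a + B₂.b) ⊔ (B₂.a + B₁.b) → x ≤ length pal
          mixed≤ h = ≤-trans (m≤n⇒m≤o⊔n (B₁.g ⊔ B₂.g) h) g≤
          open PaletteSplit (splitPalette-union pal d B₁.sizes B₂.sizes
            (≤-trans (m≤m⊔n _ _) a≤ , ≤-trans (m≤m⊔n _ _) b≤ , part≤ (m≤m⊔n _ _))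
            (≤-trans (m≤n⊔m _ _) a≤ , ≤-trans (m≤n⊔m _ _) b≤ , part≤ (m≤n⊔m _ _))
            (mixed≤ (m≤m⊔n _ _)) (mixed≤ (m≤n⊔m _ _)))

        join-colourable : β ≡ true →
          ColourableFrom W (B₁.a + B₂.a) (B₁.b + B₂.b) ((B₁.g ⊔ B₂.g) ⊔ ((B₁.a + B₂.a) ⊔ (B₁.b + B₂.b)))
        join-colourable β≡true pal d (a≤ , b≤ , g≤) =
          combine out (compatible-join β≡true) (B₁.colourable p₁ (Parts.distinct₁ out) fits₁)
                                               (B₂.colourable p₂ (Parts.distinct₂ out) fits₂)
          where
          part≤ : ∀ {x} → x ≤ B₁.g ⊔ B₂.g → x ≤ length pal
          part≤ h = ≤-trans (m≤n⇒m≤n⊔o _ h) g≤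
          open PaletteSplit (splitPalette-join pal d B₁.sizes B₂.sizes a≤ b≤ (part≤ (m≤m⊔n _ _)) (part≤ (m≤n⊔m _ _)))

        unionBlock : β ≡ false → Block W
        unionBlock β≡false = record
          { a = B₁.a ⊔ B₂.a ; b = B₁.b ⊔ B₂.b ; g = (B₁.g ⊔ B₂.g) ⊔ ((B₁.a + B₂.b) ⊔ (B₂.a + B₁.b))
          ; KA = longer B₁.KA B₂.KA ; KB = longer B₁.KB B₂.KB
          ; KG = longer largestPart largestMixed
          ; |KA| = |longer| B₁.KA B₂.KA B₁.|KA| B₂.|KA|
          ; |KB| = |longer| B₁.KB B₂.KB B₁.|KB| B₂.|KB|
          ; |KG| = |longer| largestPart largestMixed (|longer| B₁.KG B₂.KG B₁.|KG| B₂.|KG|)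
                            (|longer| (B₁.KA ++ B₂.KB) (B₂.KA ++ B₁.KB) (|++| B₁.KA B₁.|KA| B₂.|KB|)
                                (|++| B₂.KA B₂.|KA| B₁.|KB|))
          ; KA-clique = longer-preserves (Clique W IsA) (clique-⊆ W₁⊆W B₁.KA-clique) (clique-⊆ W₂⊆W B₂.KA-clique)
          ; KB-clique = longer-preserves (Clique W IsB) (clique-⊆ W₁⊆W B₁.KB-clique) (clique-⊆ W₂⊆W B₂.KB-clique)
          ; KG-clique = longer-preserves (Clique W Anything)
              (longer-preserves (Clique W Anything) (clique-⊆ W₁⊆W B₁.KG-clique) (clique-⊆ W₂⊆W B₂.KG-clique))
              (longer-preserves (Clique W Anything)
                (clique-++ (clique-forget (clique-⊆ W₁⊆W B₁.KA-clique)) (clique-forget (clique-⊆ W₂⊆W B₂.KB-clique))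
                           (union-joined₁₂ β≡false))
                (clique-++ (clique-forget (clique-⊆ W₂⊆W B₂.KA-clique)) (clique-forget (clique-⊆ W₁⊆W B₁.KB-clique))
                           (union-joined₂₁ β≡false)))
          ; sizes = unionSizes B₁.sizes B₂.sizes
          ; colourable = union-colourable β≡false }
          where
          largestPart largestMixed : List (Fin n)
          largestPart  = longer B₁.KG B₂.KG
          largestMixed = longer (B₁.KA ++ B₂.KB) (B₂.KA ++ B₁.KB)

        joinBlock : β ≡ true → Block W
        joinBlock β≡true = record
          { a = B₁.a + B₂.a ; b = B₁.b + B₂.b ; g = (B₁.g ⊔ B₂.g) ⊔ ((B₁.a + B₂.a) ⊔ (B₁.b + B₂.b))
          ; KA = B₁.KA ++ B₂.KA ; KB = B₁.KB ++ B₂.KB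
          ; KG = longer largestPart largestSame
          ; |KA| = |++| B₁.KA B₁.|KA| B₂.|KA|
          ; |KB| = |++| B₁.KB B₁.|KB| B₂.|KB|
          ; |KG| = |longer| largestPart largestSame (|longer| B₁.KG B₂.KG B₁.|KG| B₂.|KG|)
                            (|longer| (B₁.KA ++ B₂.KA) (B₁.KB ++ B₂.KB) (|++| B₁.KA B₁.|KA| B₂.|KA|)
                                (|++| B₁.KB B₁.|KB| B₂.|KB|))
          ; KA-clique = KA
          ; KB-clique = KB
          ; KG-clique = longer-preserves (Clique W Anything)
              (longer-preserves (Clique W Anything) (clique-⊆ W₁⊆W B₁.KG-clique) (clique-⊆ W₂⊆W B₂.KG-clique))
              (longer-preserves (Clique W Anything) (clique-forget KA) (clique-forget KB))
          ; sizes = joinSizes B₁.sizes B₂.sizes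
          ; colourable = join-colourable β≡true }
          where
          largestPart largestSame : List (Fin n)
          largestPart = longer B₁.KG B₂.KG
          largestSame = longer (B₁.KA ++ B₂.KA) (B₁.KB ++ B₂.KB)
          KA : Clique W IsA (B₁.KA ++ B₂.KA)
          KA = clique-++ (clique-⊆ W₁⊆W B₁.KA-clique) (clique-⊆ W₂⊆W B₂.KA-clique) (join-joinedA β≡true)
          KB : Clique W IsB (B₁.KB ++ B₂.KB)
          KB = clique-++ (clique-⊆ W₁⊆W B₁.KB-clique) (clique-⊆ W₂⊆W B₂.KB-clique) (join-joinedB β≡true)

    module Build (noP4 : NoP4 H) where
      open Decomposition H H-sym noP4

      parts-smaller : ∀ {W} (sp : Split W) → let open Composition W (side sp) (β sp) (cross sp) in
        length W₁ < length W × length W₂ < length W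
      parts-smaller {W} sp =
          filter-notAll (λ v → side sp v Bool.≟ true) W (lose w∈W (λ sw → true≢false (trans (sym sw) sw≡false)))
        , filter-notAll (λ v → side sp v Bool.≟ false) W (lose u∈W (λ su → true≢false (trans (sym su≡true) su)))
        where
        open Composition W (side sp) (β sp) (cross sp)
        u∈W = proj₁ (proj₂ (left sp))
        su≡true = proj₂ (proj₂ (left sp))
        w∈W = proj₁ (proj₂ (right sp))
        sw≡false = proj₂ (proj₂ (right sp))

      mutual
        build : ∀ k W → length W ≤ k → Block W
        build k []      _     = emptyBlock
        build k (x ∷ W) |W|≤k with allOrCounterexample (_== x) W
        ... | inj₁ allX = singletonBlock (here refl) (λ { (here refl) → refl ; (there m) → ==⇒≡ (allX m) })
        ... | inj₂ (y , y∈W , y≠x) =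
          buildSplit k (x ∷ W) |W|≤k (split (x ∷ W) (here refl) (there y∈W) (λ x≡y → ==false⇒≢ y≠x (sym x≡y)))

        buildSplit : ∀ k W → length W ≤ k → Split W → Block W
        buildSplit zero    []      _      sp with () ← proj₁ (proj₂ (left sp))
        buildSplit (suc k) W       |W|≤k  sp = compose (β sp) refl
          where
          open Composition W (side sp) (β sp) (cross sp)
          B₁ : Block W₁
          B₁ = build k W₁ (≤-pred (≤-trans (proj₁ (parts-smaller sp)) |W|≤k))
          B₂ : Block W₂
          B₂ = build k W₂ (≤-pred (≤-trans (proj₂ (parts-smaller sp)) |W|≤k))
          compose : ∀ b → β sp ≡ b → Block W
          compose false β≡false = unionBlock B₁ B₂ β≡false
          compose true  β≡true  = joinBlock B₁ B₂ β≡true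

open CographDecomposition using (NoP4; true≢false)
open LabelledColouring using (switch; switch-involutive; module Labelled)

open import Data.Nat using (ℕ; zero; suc; _≤_; _<_; _≡ᵇ_)
open import Data.Nat.Properties using (≤-refl; ≤-reflexive; ≤-trans; m≤n⇒m≤1+n; <-irrefl)
open import Data.Fin using (Fin; zero; suc; toℕ; fromℕ<; #_)
open import Data.Fin.Properties using (_≟_; toℕ-fromℕ<; injective⇒≤; all?; any?)
open import Data.Bool using (Bool; true; false; _xor_; _∨_)
import Data.Bool.Properties as Bool
open import Data.Product using (∃; _×_; _,_; proj₁; proj₂)
open import Data.Sum using (_⊎_; inj₁; inj₂)
open import Data.Empty using (⊥; ⊥-elim)
open import Data.List using (List; []; _∷_; length; lookup; allFin)
open import Data.List.Relation.Unary.All as All using (All)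
open import Data.List.Relation.Unary.Any using (here; there)
open import Data.List.Membership.Propositional using (_∈_)
open import Data.List.Membership.Propositional.Properties using (∈-allFin; ∈-lookup)
open import Data.List.Relation.Unary.AllPairs using (AllPairs; []; _∷_)
open import Data.Vec as Vec using (Vec; []; _∷_)
open import Function.Definitions using (Injective)
open import Relation.Binary.PropositionalEquality as ≡
  using (_≡_; _≢_; refl; trans; cong; cong₂; subst; module ≡-Reasoning)
open import Relation.Nullary using (¬_; Dec; yes; no; ¬?)
open import Relation.Nullary.Decidable using (True; toWitness; from-yes; _⊎-dec_; _→-dec_)
open import Defs
open Palettes using (Palette; Distinct; dnil; dcons; roomA; roomB; tR)

containsInduced-induced : (G F : Graph) (m : ℕ) (f : Fin m → Fin (n G)) →
  Injective _≡_ _≡_ f → ContainsInduced (induced G m f) F → ContainsInduced G F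
containsInduced-induced G F m f f-inj (g , g-inj , g-adj) =
  (λ x → f (g x)) , (λ e → g-inj (f-inj e)) , g-adj

switchCograph-induced : (G : Graph) (m : ℕ) (f : Fin m → Fin (n G)) →
  Injective _≡_ _≡_ f → SwitchCograph G → SwitchCograph (induced G m f)
switchCograph-induced G m f f-inj (noGem , noCoGem , noBull , noC5) =
    (λ c → noGem (inherit Gem c)) , (λ c → noCoGem (inherit CoGem c))
  , (λ c → noBull (inherit Bull c)) , (λ c → noC5 (inherit C5 c))
  where
  inherit : (F : Graph) → ContainsInduced (induced G m f) F → ContainsInduced G F
  inherit F = containsInduced-induced G F m f f-inj

Separating : Graph → Set
Separating F = ∀ x y → x ≢ y → E F x y ≡ true ⊎ ∃ λ z → E F x z ≢ E F y z

separating? : (F : Graph) → Dec (Separating F)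
separating? F = all? λ x → all? λ y → ¬? (x ≟ y) →-dec
  (E F x y Bool.≟ true ⊎-dec any? λ z → ¬? (E F x z Bool.≟ E F y z))

-- An adjacency-preserving map out of a graph without false twins is injective,
-- so an induced copy can be certified by its adjacency alone.
preserving⇒injective : (F G : Graph) (f : Fin (n F) → Fin (n G)) → Separating F →
  (∀ x y → E G (f x) (f y) ≡ E F x y) → Injective _≡_ _≡_ f
preserving⇒injective F G f sep pres {x} {y} fx≡fy with x ≟ y
... | yes x≡y = x≡y
... | no x≢y with sep x y x≢y
...   | inj₁ adj = ⊥-elim (true≢false (begin
          true              ≡⟨ ≡.sym adj ⟩
          E F x y           ≡⟨ ≡.sym (pres x y) ⟩
          E G (f x) (f y)   ≡⟨ cong (λ v → E G v (f y)) fx≡fy ⟩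
          E G (f y) (f y)   ≡⟨ irrefl G (f y) ⟩
          false             ∎))
  where open ≡-Reasoning
...   | inj₂ (z , differ) = ⊥-elim (differ (begin
          E F x z           ≡⟨ ≡.sym (pres x z) ⟩
          E G (f x) (f z)   ≡⟨ cong (λ v → E G v (f z)) fx≡fy ⟩
          E G (f y) (f z)   ≡⟨ pres y z ⟩
          E F y z           ∎))
  where open ≡-Reasoning

Realises : (Fin 5 → Fin 5 → Bool) → (F : Graph) → (Fin (n F) → Fin 5) → Set
Realises M F π = ∀ x y → M (π x) (π y) ≡ E F x y

realises? : (M : Fin 5 → Fin 5 → Bool) (F : Graph) (π : Fin (n F) → Fin 5) → Dec (Realises M F π)
realises? M F π = all? λ x → all? λ y → M (π x) (π y) Bool.≟ E F x y

data ContainsForbidden (M : Fin 5 → Fin 5 → Bool) : Set where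
  gem   : (π : Fin 5 → Fin 5) → True (realises? M Gem π) → ContainsForbidden M
  coGem : (π : Fin 5 → Fin 5) → True (realises? M CoGem π) → ContainsForbidden M
  bull  : (π : Fin 5 → Fin 5) → True (realises? M Bull π) → ContainsForbidden M
  c5    : (π : Fin 5 → Fin 5) → True (realises? M C5 π) → ContainsForbidden M

P4-E : Fin 4 → Fin 4 → Bool
P4-E i j = (toℕ i ≡ᵇ suc (toℕ j)) ∨ (toℕ j ≡ᵇ suc (toℕ i))

K1+P4 : Fin 5 → Fin 5 → Bool
K1+P4 zero    _       = false
K1+P4 (suc i) zero    = false
K1+P4 (suc i) (suc j) = P4-E i j

-- The labelling of x₀ … x₄ by their adjacency to x₀ in the original graph.
labels : Bool → Bool → Bool → Bool → Fin 5 → Bool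
labels la lb lc ld = Vec.lookup (false ∷ la ∷ lb ∷ lc ∷ ld ∷ [])

perm : Vec (Fin 5) 5 → Fin 5 → Fin 5
perm = Vec.lookup

switched-K1+P4 : ∀ la lb lc ld → ContainsForbidden (switch K1+P4 (labels la lb lc ld))
switched-K1+P4 false false false false = coGem (perm (# 1 ∷ # 2 ∷ # 3 ∷ # 4 ∷ # 0 ∷ [])) _
switched-K1+P4 false false false true  = bull  (perm (# 2 ∷ # 4 ∷ # 1 ∷ # 3 ∷ # 0 ∷ [])) _
switched-K1+P4 false false true  false = coGem (perm (# 0 ∷ # 3 ∷ # 1 ∷ # 2 ∷ # 4 ∷ [])) _
switched-K1+P4 false false true  true  = gem   (perm (# 0 ∷ # 3 ∷ # 1 ∷ # 2 ∷ # 4 ∷ [])) _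
switched-K1+P4 false true  false false = coGem (perm (# 0 ∷ # 2 ∷ # 4 ∷ # 3 ∷ # 1 ∷ [])) _
switched-K1+P4 false true  false true  = coGem (perm (# 1 ∷ # 4 ∷ # 0 ∷ # 2 ∷ # 3 ∷ [])) _
switched-K1+P4 false true  true  false = bull  (perm (# 2 ∷ # 3 ∷ # 0 ∷ # 4 ∷ # 1 ∷ [])) _
switched-K1+P4 false true  true  true  = gem   (perm (# 1 ∷ # 4 ∷ # 0 ∷ # 2 ∷ # 3 ∷ [])) _
switched-K1+P4 true  false false false = bull  (perm (# 1 ∷ # 3 ∷ # 4 ∷ # 0 ∷ # 2 ∷ [])) _
switched-K1+P4 true  false false true  = c5    (perm (# 0 ∷ # 1 ∷ # 3 ∷ # 2 ∷ # 4 ∷ [])) _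
switched-K1+P4 true  false true  false = coGem (perm (# 3 ∷ # 0 ∷ # 1 ∷ # 4 ∷ # 2 ∷ [])) _
switched-K1+P4 true  false true  true  = bull  (perm (# 0 ∷ # 4 ∷ # 3 ∷ # 1 ∷ # 2 ∷ [])) _
switched-K1+P4 true  true  false false = gem   (perm (# 0 ∷ # 2 ∷ # 4 ∷ # 3 ∷ # 1 ∷ [])) _
switched-K1+P4 true  true  false true  = bull  (perm (# 0 ∷ # 1 ∷ # 2 ∷ # 4 ∷ # 3 ∷ [])) _
switched-K1+P4 true  true  true  false = gem   (perm (# 3 ∷ # 0 ∷ # 1 ∷ # 4 ∷ # 2 ∷ [])) _
switched-K1+P4 true  true  true  true  = gem   (perm (# 1 ∷ # 2 ∷ # 3 ∷ # 4 ∷ # 0 ∷ [])) _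

module SwitchAt (G : Graph) (x₀ : Fin (n G)) where

  V : Set
  V = Fin (n G)

  ℓ : V → Bool
  ℓ = E G x₀

  open Labelled (E G) (sym G) (irrefl G) ℓ using (H; H-sym)

  H-irrefl : ∀ x → H x x ≡ false
  H-irrefl x = trans (cong (_xor (ℓ x xor ℓ x)) (irrefl G x)) (Bool.xor-same (ℓ x))

  H-isolated : ∀ y → H x₀ y ≡ false
  H-isolated y = trans (cong (λ z → ℓ y xor (z xor ℓ y)) (irrefl G x₀)) (Bool.xor-same (ℓ y))

  -- An induced P4 abcd of H, together with x₀, would span one of the
  -- forbidden graphs in G.
  P4-free : SwitchCograph G → NoP4 H
  P4-free (noGem , noCoGem , noBull , noC5) a b c d ab bc cd ac bd ad =
    excluded (switched-K1+P4 (ℓ a) (ℓ b) (ℓ c) (ℓ d))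
    where
    path : ∀ i j → H (Vec.lookup (a ∷ b ∷ c ∷ d ∷ []) i) (Vec.lookup (a ∷ b ∷ c ∷ d ∷ []) j) ≡ P4-E i j
    path zero                   zero                   = H-irrefl a
    path zero                   (suc zero)             = ab
    path zero                   (suc (suc zero))       = ac
    path zero                   (suc (suc (suc zero))) = ad
    path (suc zero)             zero                   = trans (H-sym b a) ab
    path (suc zero)             (suc zero)             = H-irrefl b
    path (suc zero)             (suc (suc zero))       = bc
    path (suc zero)             (suc (suc (suc zero))) = bd
    path (suc (suc zero))       zero                   = trans (H-sym c a) ac
    path (suc (suc zero))       (suc zero)             = trans (H-sym c b) bc
    path (suc (suc zero))       (suc (suc zero))       = H-irrefl c
    path (suc (suc zero))       (suc (suc (suc zero))) = cd
    path (suc (suc (suc zero))) zero                   = trans (H-sym d a) ad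
    path (suc (suc (suc zero))) (suc zero)             = trans (H-sym d b) bd
    path (suc (suc (suc zero))) (suc (suc zero))       = trans (H-sym d c) cd
    path (suc (suc (suc zero))) (suc (suc (suc zero))) = H-irrefl d

    w : Fin 5 → V
    w = Vec.lookup (x₀ ∷ a ∷ b ∷ c ∷ d ∷ [])

    shape : ∀ i j → H (w i) (w j) ≡ K1+P4 i j
    shape zero    j       = H-isolated (w j)
    shape (suc i) zero    = trans (H-sym (w (suc i)) x₀) (H-isolated (w (suc i)))
    shape (suc i) (suc j) = path i j

    label : ∀ i → ℓ (w i) ≡ labels (ℓ a) (ℓ b) (ℓ c) (ℓ d) i
    label zero                         = irrefl G x₀
    label (suc zero)                   = refl
    label (suc (suc zero))             = refl
    label (suc (suc (suc zero)))       = refl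
    label (suc (suc (suc (suc zero)))) = refl

    realised : ∀ i j → E G (w i) (w j) ≡ switch K1+P4 (labels (ℓ a) (ℓ b) (ℓ c) (ℓ d)) i j
    realised i j = trans (≡.sym (switch-involutive (E G) ℓ (w i) (w j)))
                         (cong₂ _xor_ (shape i j) (cong₂ _xor_ (label i) (label j)))

    embed : (F : Graph) (π : Fin (n F) → Fin 5) → Separating F →
            Realises (switch K1+P4 (labels (ℓ a) (ℓ b) (ℓ c) (ℓ d))) F π → ContainsInduced G F
    embed F π sep real = (λ x → w (π x)) , preserving⇒injective F G (λ x → w (π x)) sep pres , pres
      where
      pres : ∀ x y → E G (w (π x)) (w (π y)) ≡ E F x y
      pres x y = trans (realised (π x) (π y)) (real x y)

    excluded : ContainsForbidden (switch K1+P4 (labels (ℓ a) (ℓ b) (ℓ c) (ℓ d))) → ⊥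
    excluded (gem π r)   = noGem   (embed Gem π (from-yes (separating? Gem)) (toWitness r))
    excluded (coGem π r) = noCoGem (embed CoGem π (from-yes (separating? CoGem)) (toWitness r))
    excluded (bull π r)  = noBull  (embed Bull π (from-yes (separating? Bull)) (toWitness r))
    excluded (c5 π r)    = noC5    (embed C5 π (from-yes (separating? C5)) (toWitness r))

sharedPalette : ℕ → Palette
sharedPalette zero    = []
sharedPalette (suc k) = (tR , k) ∷ sharedPalette k

sharedPalette-bound : ∀ {k t c} → (t , c) ∈ sharedPalette k → c < k
sharedPalette-bound {suc k} (here refl) = ≤-refl
sharedPalette-bound {suc k} (there m)   = m≤n⇒m≤1+n (sharedPalette-bound m)

sharedPalette-distinct : ∀ k → Distinct (sharedPalette k)
sharedPalette-distinct zero    = dnil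
sharedPalette-distinct (suc k) =
  dcons (λ m → <-irrefl refl (sharedPalette-bound m)) (sharedPalette-distinct k)

sharedPalette-roomA : ∀ k → roomA (sharedPalette k) ≡ k
sharedPalette-roomA zero    = refl
sharedPalette-roomA (suc k) = cong suc (sharedPalette-roomA k)

sharedPalette-roomB : ∀ k → roomB (sharedPalette k) ≡ k
sharedPalette-roomB zero    = refl
sharedPalette-roomB (suc k) = cong suc (sharedPalette-roomB k)

sharedPalette-length : ∀ k → length (sharedPalette k) ≡ k
sharedPalette-length zero    = refl
sharedPalette-length (suc k) = cong suc (sharedPalette-length k)

listClique : (G : Graph) (K : List (Fin (n G))) → AllPairs (Adj G) K → HasClique G (length K)
listClique G K pairs = lookup K , lookup-injective , lookup-adjacent pairs
  where
  lookup-adjacent : ∀ {K} → AllPairs (Adj G) K → ∀ i j → i ≢ j → Adj G (lookup K i) (lookup K j)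
  lookup-adjacent (_ ∷ _)   zero    zero    i≢j = ⊥-elim (i≢j refl)
  lookup-adjacent (px ∷ _)  zero    (suc j) _   = All.lookup px (∈-lookup j)
  lookup-adjacent (px ∷ _)  (suc i) zero    _   = trans (sym G _ _) (All.lookup px (∈-lookup i))
  lookup-adjacent (_ ∷ ps)  (suc i) (suc j) i≢j = lookup-adjacent ps i j (λ e → i≢j (cong suc e))

  lookup-injective : Injective _≡_ _≡_ (lookup K)
  lookup-injective {i} {j} e with i ≟ j
  ... | yes i≡j = i≡j
  ... | no i≢j  = ⊥-elim (true≢false (begin
        true                                ≡⟨ ≡.sym (lookup-adjacent pairs i j i≢j) ⟩
        E G (lookup K i) (lookup K j)       ≡⟨ cong (λ v → E G v (lookup K j)) e ⟩
        E G (lookup K j) (lookup K j)       ≡⟨ irrefl G (lookup K j) ⟩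
        false                               ∎))
    where open ≡-Reasoning

-- A switch cograph with a vertex x₀ has a clique and a proper colouring of
-- the same size: switch at x₀, build the labelled decomposition of the
-- resulting cograph, and colour it from the palette of g shared colours, g
-- being the size of the clique the decomposition provides.
cliqueAndColouringAt : (G : Graph) → SwitchCograph G → Fin (n G) →
  ∃ λ k → HasClique G k × Colourable G k
cliqueAndColouringAt G sc x₀ =
  Block.g B , subst (HasClique G) (Block.|KG| B) (listClique G (Block.KG B) (pairwise (Block.KG-clique B))) , colouring
  where
  open SwitchAt G x₀ using (ℓ; P4-free)
  open Labelled (E G) (sym G) (irrefl G) ℓ using (Block; pairwise; PaletteColouring; module Build)
  B : Block (allFin (n G))
  B = Build.build (P4-free sc) (length (allFin (n G))) (allFin (n G)) ≤-refl
  g : ℕ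
  g = Block.g B
  colours : PaletteColouring (allFin (n G)) (sharedPalette g)
  colours = Block.colourable B (sharedPalette g) (sharedPalette-distinct g)
              ( ≤-trans (proj₁ (Block.sizes B)) (≤-reflexive (≡.sym (sharedPalette-roomA g)))
              , ≤-trans (proj₁ (proj₂ (Block.sizes B))) (≤-reflexive (≡.sym (sharedPalette-roomB g)))
              , ≤-reflexive (≡.sym (sharedPalette-length g)) )
  c : Fin (n G) → ℕ
  c = proj₁ colours
  bound : ∀ v → c v < g
  bound v = sharedPalette-bound (proj₁ (proj₂ (proj₁ (proj₂ colours) v (∈-allFin v))))
  colouring : Colourable G g
  colouring = (λ v → fromℕ< (bound v))
            , (λ x y adj eq → proj₂ (proj₂ colours) x y (∈-allFin x) (∈-allFin y) adj
                (trans (≡.sym (toℕ-fromℕ< (bound x))) (trans (cong toℕ eq) (toℕ-fromℕ< (bound y)))))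

cliqueAndColouring : (G : Graph) → SwitchCograph G → ∃ λ k → HasClique G k × Colourable G k
cliqueAndColouring G sc = byOrder (n G) refl
  where
  byOrder : ∀ m → n G ≡ m → ∃ λ k → HasClique G k × Colourable G k
  byOrder zero    n≡0 = 0 , ((λ ()) , (λ { {()} }) , (λ ())) , (λ v → ⊥-elim (noVertex v)) , (λ v → ⊥-elim (noVertex v))
    where
    noVertex : Fin (n G) → ⊥
    noVertex v with () ← subst Fin n≡0 v
  byOrder (suc _) n≡  = cliqueAndColouringAt G sc (subst Fin (≡.sym n≡) zero)

-- A clique must receive pairwise different colours.
clique≤colours : (G : Graph) {j k : ℕ} → HasClique G j → Colourable G k → j ≤ k
clique≤colours G (K , _ , K-adj) (c , proper) = injective⇒≤ {f = λ i → c (K i)} distinct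
  where
  distinct : ∀ {x y} → c (K x) ≡ c (K y) → x ≡ y
  distinct {x} {y} e with x ≟ y
  ... | yes x≡y = x≡y
  ... | no x≢y  = ⊥-elim (proper (K x) (K y) (K-adj x y x≢y) e)

χ≡ω : (G : Graph) (k : ℕ) → HasClique G k → Colourable G k →
  IsChromaticNumber G k × IsCliqueNumber G k
χ≡ω G k K c = (c , λ j c′ → clique≤colours G K c′) , (K , λ j K′ → clique≤colours G K′ c)

-- Every switch cograph is perfect: its induced subgraphs are switch cographs
-- again, and each has a clique and a colouring of equal size.
mainTheorem8 : (G : Graph) → SwitchCograph G → Perfect G
mainTheorem8 G sc m f f-inj with cliqueAndColouring (induced G m f) (switchCograph-induced G m f f-inj sc)
... | k , K , c = k , χ≡ω (induced G m f) k K c
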